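{- Let $n>m$ be positive integers, $d=\gcd(n,m)$, and $\varepsilon,\varepsilon'\in\{ -1,1\}$. Suppose that $(n/d,m/d,\varepsilon,\varepsilon')$ falls into one of the reducible cases (i)–(iii) below, so that $x^{n/d}+\varepsilon x^{m/d}+\varepsilon'=g(x)h(x)$ with $g$ as specified and $h\in\mathbb Z[x]$, and hence $x^n+\varepsilon x^m+\varepsilon'=g(x^d)h(x^d)$. Then \[\operatorname{Res}\big(g(x^d),h(x^d)\big)=\left(\frac{n^2-mn+m^2}{3d^2}\right)^d.\]
   Context: Write $n_0=n/d$, $m_0=m/d$ (coprime). The reducible cases are: (i) $(n_0,m_0)\equiv(1,5)$ or $(5,1)\pmod 6$ and $\varepsilon=1$, with $g(x)=x^2+\varepsilon'x+1$; (ii) $(n_0,m_0)\equiv(2,1)$ or $(4,5)\pmod 6$ and $\varepsilon'=1$, with $g(x)=x^2+\varepsilon x+1$; (iii) $(n_0,m_0)\equiv(1,2)$ or $(5,4)\pmod 6$ and $\varepsilon=\varepsilon'$, with $g(x)=x^2+\varepsilon x+1$. In each case $g$ divides $x^{n_0}+\varepsilon x^{m_0}+\varepsilon'$ and $h$ is the cofactor (by a theorem of Ljunggren, these are exactly the cases in which $x^n+\varepsilon x^m+\varepsilon'$ is reducible). $\operatorname{Res}$ denotes the resultant; for monic $G$ with roots $\alpha_i$ (with multiplicity), $\operatorname{Res}(G,H)=\prod_i H(\alpha_i)$. -}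

module Defs where

open import Data.Nat using (ℕ; zero; suc; _∸_; _%_)
open import Data.Integer using (ℤ; +_; -_; _+_; _*_)
open import Data.Fin using (Fin; zero; suc; toℕ; punchIn; _≤?_)
open import Data.List using (List; []; _∷_; replicate; _++_; map)
open import Data.Product using (_×_)
open import Data.Sum using (_⊎_)
open import Relation.Binary.PropositionalEquality using (_≡_)
open import Relation.Nullary using (yes; no)

-- Polynomials over ℤ as coefficient lists, lowest degree first.
Poly : Set
Poly = List ℤ

consN : ℤ → Poly → Poly
consN (+ 0) [] = []
consN c r = c ∷ r

trim : Poly → Poly
trim [] = []
trim (c ∷ cs) = consN c (trim cs)

_≈ₚ_ : Poly → Poly → Set
p ≈ₚ q = trim p ≡ trim q

_+ₚ_ : Poly → Poly → Poly
[] +ₚ q = q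
(a ∷ p) +ₚ [] = a ∷ p
(a ∷ p) +ₚ (b ∷ q) = (a + b) ∷ (p +ₚ q)

_*ₚ_ : Poly → Poly → Poly
[] *ₚ q = []
(a ∷ p) *ₚ q = map (a *_) q +ₚ (+ 0 ∷ (p *ₚ q))

monomial : ℕ → ℤ → Poly
monomial k c = replicate k (+ 0) ++ (c ∷ [])

trinomial : ℕ → ℕ → ℤ → ℤ → Poly
trinomial n m ε ε' = monomial n (+ 1) +ₚ (monomial m ε +ₚ monomial 0 ε')

-- p(x^d)   (for d ≥ 1)
compose : ℕ → Poly → Poly
compose d [] = []
compose d (c ∷ cs) = c ∷ (replicate (d ∸ 1) (+ 0) ++ compose d cs)

coeff : Poly → ℕ → ℤ
coeff [] k = + 0
coeff (c ∷ cs) zero = c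
coeff (c ∷ cs) (suc k) = coeff cs k

-- formal degree of a list (length - 1; 0 for the empty list)
len : Poly → ℕ
len [] = 0
len (_ ∷ cs) = suc (len cs)

deg : Poly → ℕ
deg p = len p ∸ 1

sumFin : ∀ n → (Fin n → ℤ) → ℤ
sumFin zero f = + 0
sumFin (suc n) f = f zero + sumFin n (λ i → f (suc i))

alt : ℕ → ℤ
alt zero = + 1
alt (suc k) = - alt k

det : ∀ n → (Fin n → Fin n → ℤ) → ℤ
det zero M = + 1
det (suc n) M =
  sumFin (suc n) (λ j → alt (toℕ j) * (M zero j * det n (λ r c → M (suc r) (punchIn j c))))

-- Sylvester matrix of p (degree a) and q (degree b), size a + b.
-- Rows i < b : p_a,…,p_0 starting at column i;
-- rows b + k : q_b,…,q_0 starting at column k.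
shiftEntry : Poly → ℕ → ℕ → ℕ → ℤ
shiftEntry p e s j with s Data.Nat.≤? j
... | no _ = + 0
... | yes _ with (j ∸ s) Data.Nat.≤? e
...   | no _ = + 0
...   | yes _ = coeff p (e ∸ (j ∸ s))

sylvester : (p q : Poly) → Fin (deg p Data.Nat.+ deg q) → Fin (deg p Data.Nat.+ deg q) → ℤ
sylvester p q i j with suc (toℕ i) Data.Nat.≤? deg q
... | yes _ = shiftEntry p (deg p) (toℕ i) (toℕ j)
... | no _ = shiftEntry q (deg q) (toℕ i ∸ deg q) (toℕ j)

-- Resultant: determinant of the Sylvester matrix of the normalised polynomials.
-- For monic G this equals ∏ H(α) over the roots α of G.
Res' : Poly → Poly → ℤ
Res' p q = det (deg p Data.Nat.+ deg q) (sylvester p q)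

Res : Poly → Poly → ℤ
Res p q = Res' (trim p) (trim q)

IsSign : ℤ → Set
IsSign e = e ≡ + 1 ⊎ e ≡ - (+ 1)

-- Ljunggren's reducible cases, with the corresponding quadratic factor g.
data LjCase (n₀ m₀ : ℕ) (ε ε' : ℤ) : Poly → Set where
  case-i   : ((n₀ % 6 ≡ 1 × m₀ % 6 ≡ 5) ⊎ (n₀ % 6 ≡ 5 × m₀ % 6 ≡ 1)) → ε ≡ + 1 →
             LjCase n₀ m₀ ε ε' (+ 1 ∷ ε' ∷ + 1 ∷ [])
  case-ii  : ((n₀ % 6 ≡ 2 × m₀ % 6 ≡ 1) ⊎ (n₀ % 6 ≡ 4 × m₀ % 6 ≡ 5)) → ε' ≡ + 1 →
             LjCase n₀ m₀ ε ε' (+ 1 ∷ ε ∷ + 1 ∷ [])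
  case-iii : ((n₀ % 6 ≡ 1 × m₀ % 6 ≡ 2) ⊎ (n₀ % 6 ≡ 5 × m₀ % 6 ≡ 4)) → ε ≡ ε' →
             LjCase n₀ m₀ ε ε' (+ 1 ∷ ε ∷ + 1 ∷ [])

-- The Sylvester matrix of g(xᵈ) and h(xᵈ) is, after reindexing, the Kronecker product of the
-- Sylvester matrix of g and h with the d × d identity; row operations on the small matrix lift to
-- the large one, so Res(g(xᵈ), h(xᵈ)) = Res(g, h)ᵈ. For g = 1 + c x + x² the coefficients of h read
-- from the top are those of (1 + ε x^(n₀ - m₀)) / g, and subtracting multiples of the g-rows reduces
-- Res(g, h) to the norm p₀² + c p₀ p₁ + p₁², where p₀ and p₁ are the coefficients of x^(n₀ - 2) and
-- x^(n₀ - 3) in (1 + ε x^(n₀ - m₀)) / g². For c = ±1 the coefficients of 1 / g² are linear in the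
-- exponent on each residue class mod 6, and in each of Ljunggren's cases this gives
-- 3 Res(g, h) = n₀² - n₀ m₀ + m₀²; scaling by d² yields the formula.
module Submission where

open import Data.Nat using (ℕ)

module Sequences where

  open import Data.Nat as ℕ using (ℕ; zero; suc; _≤_; _<_; _∸_; z≤n; s≤s)
  import Data.Nat.Properties as ℕP
  open import Data.Integer using (ℤ; -_; _+_; _*_; _-_; 0ℤ; 1ℤ)
  open import Data.Integer.Properties
  open import Data.Integer.Tactic.RingSolver using (solve-∀)
  open import Data.Empty using (⊥-elim)
  open import Data.Sum using (inj₁; inj₂)
  open import Data.Product using (_×_; _,_; proj₁)
  open import Function using (_∘_)
  open import Relation.Binary.PropositionalEquality
  open import Relation.Nullary using (yes; no)
  open import Algebra.Properties.AbelianGroup +-0-abelianGroup using (∙-cancelʳ)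

  -- Sequences are power series Σ f t xᵗ: shift k multiplies by xᵏ, and δ a is xᵃ.
  Seq : Set
  Seq = ℕ → ℤ

  shift : ℕ → Seq → Seq
  shift zero    f t       = f t
  shift (suc k) f zero    = 0ℤ
  shift (suc k) f (suc t) = shift k f t

  δ : ℕ → ℕ → ℤ
  δ zero    zero    = 1ℤ
  δ zero    (suc _) = 0ℤ
  δ (suc _) zero    = 0ℤ
  δ (suc a) (suc b) = δ a b

  shift-shift : ∀ j k f t → shift j (shift k f) t ≡ shift (j ℕ.+ k) f t
  shift-shift zero    k f t       = refl
  shift-shift (suc j) k f zero    = refl
  shift-shift (suc j) k f (suc t) = shift-shift j k f t

  shift-cong : ∀ k {f g} → (∀ t → f t ≡ g t) → ∀ t → shift k f t ≡ shift k g t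
  shift-cong zero    f≗g t       = f≗g t
  shift-cong (suc k) f≗g zero    = refl
  shift-cong (suc k) f≗g (suc t) = shift-cong k f≗g t

  shift-cong-≤ : ∀ k {f g} T → (∀ t → t ≤ T → f t ≡ g t) → ∀ t → t ≤ T → shift k f t ≡ shift k g t
  shift-cong-≤ zero    T f≗g t       t≤T = f≗g t t≤T
  shift-cong-≤ (suc k) T f≗g zero    _   = refl
  shift-cong-≤ (suc k) T f≗g (suc t) t≤T = shift-cong-≤ k T f≗g t (ℕP.<⇒≤ t≤T)

  shift-suc-agree : ∀ j {f g} t → (∀ u → u < t → f u ≡ g u) → shift (suc j) f t ≡ shift (suc j) g t
  shift-suc-agree j       zero    _   = refl
  shift-suc-agree zero    (suc t) f≗g = f≗g t ℕP.≤-refl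
  shift-suc-agree (suc j) (suc t) f≗g = shift-suc-agree j t (λ u u<t → f≗g u (ℕP.m≤n⇒m≤1+n u<t))

  shift-+ : ∀ k f g t → shift k (λ s → f s + g s) t ≡ shift k f t + shift k g t
  shift-+ zero    f g t       = refl
  shift-+ (suc k) f g zero    = refl
  shift-+ (suc k) f g (suc t) = shift-+ k f g t

  shift-* : ∀ k u f t → shift k (λ s → u * f s) t ≡ u * shift k f t
  shift-* zero    u f t       = refl
  shift-* (suc k) u f zero    = sym (*-zeroʳ u)
  shift-* (suc k) u f (suc t) = shift-* k u f t

  shift-neg : ∀ k f t → shift k (λ s → - f s) t ≡ - shift k f t
  shift-neg zero    f t       = refl
  shift-neg (suc k) f zero    = refl
  shift-neg (suc k) f (suc t) = shift-neg k f t

  shift-at-+ : ∀ k f t → shift k f (k ℕ.+ t) ≡ f t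
  shift-at-+ zero    f t = refl
  shift-at-+ (suc k) f t = shift-at-+ k f t

  shift-<-zero : ∀ k f t → t < k → shift k f t ≡ 0ℤ
  shift-<-zero (suc k) f zero    _         = refl
  shift-<-zero (suc k) f (suc t) (s≤s t<k) = shift-<-zero k f t t<k

  shift-cancelˡ : ∀ j k f t → shift (j ℕ.+ k) f (j ℕ.+ t) ≡ shift k f t
  shift-cancelˡ zero    k f t = refl
  shift-cancelˡ (suc j) k f t = shift-cancelˡ j k f t

  shift-δ : ∀ k a t → shift k (δ a) t ≡ δ (k ℕ.+ a) t
  shift-δ zero    a t       = refl
  shift-δ (suc k) a zero    = refl
  shift-δ (suc k) a (suc t) = shift-δ k a t

  δ-refl : ∀ a → δ a a ≡ 1ℤ
  δ-refl zero    = refl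
  δ-refl (suc a) = δ-refl a

  δ-≢ : ∀ {a b} → a ≢ b → δ a b ≡ 0ℤ
  δ-≢ {zero}  {zero}  a≢b = ⊥-elim (a≢b refl)
  δ-≢ {zero}  {suc b} _   = refl
  δ-≢ {suc a} {zero}  _   = refl
  δ-≢ {suc a} {suc b} a≢b = δ-≢ (a≢b ∘ cong suc)

  δ-sym : ∀ a b → δ a b ≡ δ b a
  δ-sym zero    zero    = refl
  δ-sym zero    (suc b) = refl
  δ-sym (suc a) zero    = refl
  δ-sym (suc a) (suc b) = δ-sym a b

  δ-cong-⇔ : ∀ {a b a′ b′} → (a ≡ b → a′ ≡ b′) → (a′ ≡ b′ → a ≡ b) → δ a b ≡ δ a′ b′
  δ-cong-⇔ {a} {b} {a′} {b′} to from with a ℕ.≟ b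
  ... | yes refl = trans (δ-refl a) (sym (subst (λ x → δ a′ x ≡ 1ℤ) (to refl) (δ-refl a′)))
  ... | no a≢b   = trans (δ-≢ a≢b) (sym (δ-≢ (a≢b ∘ from)))

  -- The rows of a Sylvester matrix are shifts of reversed coefficient sequences.
  reverse : ℕ → Seq → Seq
  reverse e f x with x ℕ.≤? e
  ... | yes _ = f (e ∸ x)
  ... | no  _ = 0ℤ

  reverse-≤ : ∀ e f x → x ≤ e → reverse e f x ≡ f (e ∸ x)
  reverse-≤ e f x x≤e with x ℕ.≤? e
  ... | yes _   = refl
  ... | no  x≰e = ⊥-elim (x≰e x≤e)

  reverse-> : ∀ e f x → e < x → reverse e f x ≡ 0ℤ
  reverse-> e f x e<x with x ℕ.≤? e
  ... | yes x≤e = ⊥-elim (ℕP.<⇒≱ e<x x≤e)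
  ... | no  _   = refl

  reverse-suc : ∀ e f x → reverse (suc e) f (suc x) ≡ reverse e f x
  reverse-suc e f x with x ℕ.≤? e
  ... | yes x≤e = reverse-≤ (suc e) f (suc x) (s≤s x≤e)
  ... | no  x≰e = reverse-> (suc e) f (suc x) (s≤s (ℕP.≰⇒> x≰e))

  reverse-+ : ∀ k e f x → reverse (k ℕ.+ e) f (k ℕ.+ x) ≡ reverse e f x
  reverse-+ zero    e f x = refl
  reverse-+ (suc k) e f x = trans (reverse-suc (k ℕ.+ e) f (k ℕ.+ x)) (reverse-+ k e f x)

  reverse-cong : ∀ e {f g} → (∀ u → f u ≡ g u) → ∀ x → reverse e f x ≡ reverse e g x
  reverse-cong e f≗g x with x ℕ.≤? e
  ... | yes _ = f≗g (e ∸ x)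
  ... | no  _ = refl

  module Quadratic (c : ℤ) where

    mulG : Seq → Seq
    mulG f t = f t + c * shift 1 f t + shift 2 f t

    divG : Seq → Seq
    divG φ zero          = φ 0
    divG φ (suc zero)    = φ 1 - c * divG φ 0
    divG φ (suc (suc t)) = φ (suc (suc t)) - c * divG φ (suc t) - divG φ t

    mulG-divG : ∀ φ t → mulG (divG φ) t ≡ φ t
    mulG-divG φ zero          = by-ring (φ 0) c
      where by-ring : ∀ a c → a + c * 0ℤ + 0ℤ ≡ a
            by-ring = solve-∀
    mulG-divG φ (suc zero)    = by-ring (φ 1) (divG φ 0) c
      where by-ring : ∀ a x c → a - c * x + c * x + 0ℤ ≡ a
            by-ring = solve-∀
    mulG-divG φ (suc (suc t)) = by-ring (φ (suc (suc t))) (divG φ (suc t)) (divG φ t) c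
      where by-ring : ∀ a x y c → a - c * x - y + c * x + y ≡ a
            by-ring = solve-∀

    mulG-shift : ∀ k f t → mulG (shift k f) t ≡ shift k (mulG f) t
    mulG-shift zero    f t       = refl
    mulG-shift (suc k) f zero    = by-ring c
      where by-ring : ∀ c → 0ℤ + c * 0ℤ + 0ℤ ≡ 0ℤ
            by-ring = solve-∀
    mulG-shift (suc k) f (suc t) =
      trans (cong₂ (λ x y → shift k f t + c * x + y)
                   (trans (shift-shift 1 (suc k) f (suc t)) (sym (shift-shift 1 k f t)))
                   (trans (shift-shift 2 (suc k) f (suc t)) (sym (shift-shift 2 k f t))))
            (mulG-shift k f t)

    mulG-+ : ∀ f u v t → mulG (λ s → f s + u * v s) t ≡ mulG f t + u * mulG v t
    mulG-+ f u v t rewrite shift-+ 1 f (λ s → u * v s) t | shift-+ 2 f (λ s → u * v s) t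
                           | shift-* 1 u v t | shift-* 2 u v t =
      by-ring (f t) (v t) (shift 1 f t) (shift 1 v t) (shift 2 f t) (shift 2 v t) c u
      where by-ring : ∀ a b a₁ b₁ a₂ b₂ c u →
                   a + u * b + c * (a₁ + u * b₁) + (a₂ + u * b₂) ≡ a + c * a₁ + a₂ + u * (b + c * b₁ + b₂)
            by-ring = solve-∀

    mulG-agree : ∀ f g t → (∀ u → u ≤ t → f u ≡ g u) → mulG f t ≡ mulG g t
    mulG-agree f g t f≗g =
      cong₂ _+_ (cong₂ (λ x y → x + c * y) (f≗g t ℕP.≤-refl) (shift-cong-≤ 1 t f≗g t ℕP.≤-refl))
                (shift-cong-≤ 2 t f≗g t ℕP.≤-refl)

    mulG-injective-< : ∀ f g T → (∀ t → t < T → mulG f t ≡ mulG g t) → ∀ t → t < T → f t ≡ g t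
    mulG-injective-< f g (suc T) Lf≗Lg t t<1+T with ℕP.m≤n⇒m<n∨m≡n (ℕP.≤-pred t<1+T)
    ... | inj₁ t<T = mulG-injective-< f g T (λ u u<T → Lf≗Lg u (ℕP.m≤n⇒m≤1+n u<T)) t t<T
    ... | inj₂ refl = ∙-cancelʳ (c * shift 1 f t + shift 2 f t) (f t) (g t) (begin
        f t + (c * shift 1 f t + shift 2 f t) ≡⟨ +-assoc (f t) _ _ ⟨
        mulG f t                              ≡⟨ Lf≗Lg t ℕP.≤-refl ⟩
        mulG g t                              ≡⟨ +-assoc (g t) _ _ ⟩
        g t + (c * shift 1 g t + shift 2 g t) ≡⟨ cong (λ r → g t + r) tails ⟨
        g t + (c * shift 1 f t + shift 2 f t) ∎)
      where
      open ≡-Reasoning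
      below : ∀ u → u < t → f u ≡ g u
      below = mulG-injective-< f g t (λ u u<t → Lf≗Lg u (ℕP.m≤n⇒m≤1+n u<t))
      tails : c * shift 1 f t + shift 2 f t ≡ c * shift 1 g t + shift 2 g t
      tails = cong₂ (λ x y → c * x + y) (shift-suc-agree 0 t below) (shift-suc-agree 1 t below)

    mulG-zero-tail : ∀ f b L → (∀ k → L ≤ k → f k ≡ 0ℤ) → (∀ k → b < k → mulG f (2 ℕ.+ k) ≡ 0ℤ) →
                     ∀ k → b < k → f k ≡ 0ℤ
    mulG-zero-tail f b L f-eventually f-annihilated k b<k = proj₁ (by-fuel L k b<k (ℕP.m≤n+m L k))
      where
      by-fuel : ∀ m k → b < k → L ≤ k ℕ.+ m → f k ≡ 0ℤ × f (suc k) ≡ 0ℤ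
      by-fuel zero    k _   L≤k = f-eventually k (subst (L ≤_) (ℕP.+-identityʳ k) L≤k)
                                , f-eventually (suc k) (ℕP.m≤n⇒m≤1+n (subst (L ≤_) (ℕP.+-identityʳ k) L≤k))
      by-fuel (suc m) k b<k L≤k+1+m with by-fuel m (suc k) (ℕP.m≤n⇒m≤1+n b<k) (subst (L ≤_) (ℕP.+-suc k m) L≤k+1+m)
      ... | f₁≡0 , f₂≡0 = trans (by-ring (f k) c) (trans (cong₂ (λ x y → x + c * y + f k) (sym f₂≡0) (sym f₁≡0))
                                                       (f-annihilated k b<k))
                        , f₁≡0
        where by-ring : ∀ z c → z ≡ 0ℤ + c * 0ℤ + z
              by-ring = solve-∀

    shift-reverse : ∀ b f → (∀ u → b < u → f u ≡ 0ℤ) → ∀ j t k → t ℕ.+ k ≡ b → shift j (reverse b f) t ≡ f (k ℕ.+ j)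
    shift-reverse b f f-above zero    t       k t+k≡b =
      trans (reverse-≤ b f t (subst (t ≤_) t+k≡b (ℕP.m≤m+n t k)))
            (cong f (trans (cong (_∸ t) (sym t+k≡b)) (trans (ℕP.m+n∸m≡n t k) (sym (ℕP.+-identityʳ k)))))
    shift-reverse b f f-above (suc j) zero    k refl  = sym (f-above (k ℕ.+ suc j) (ℕP.m<m+n k (s≤s z≤n)))
    shift-reverse b f f-above (suc j) (suc t) k t+k≡b =
      trans (shift-reverse b f f-above j t (suc k) (trans (ℕP.+-suc t k) t+k≡b)) (cong f (sym (ℕP.+-suc k j)))

    -- g is palindromic, so it commutes with reversal.
    mulG-reverse : ∀ b f → (∀ u → b < u → f u ≡ 0ℤ) → ∀ t k → t ℕ.+ k ≡ b → mulG (reverse b f) t ≡ mulG f (2 ℕ.+ k)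
    mulG-reverse b f f-above t k t+k≡b =
      trans (cong₂ (λ x y → x + c * y + shift 2 (reverse b f) t)
                   (trans (shift-reverse b f f-above 0 t k t+k≡b) (cong f (ℕP.+-identityʳ k)))
                   (trans (shift-reverse b f f-above 1 t k t+k≡b) (cong f (ℕP.+-comm k 1))))
            (trans (cong (λ z → f k + c * f (suc k) + z)
                         (trans (shift-reverse b f f-above 2 t k t+k≡b) (cong f (ℕP.+-comm k 2))))
                   (by-ring (f k) (f (suc k)) (f (2 ℕ.+ k)) c))
      where by-ring : ∀ x y z c → x + c * y + z ≡ z + c * y + x
            by-ring = solve-∀

    mulG-binomial : ∀ e u f φ → (∀ t → mulG f t ≡ φ t) → ∀ t →
      mulG (λ s → f s + u * shift e f s) t ≡ φ t + u * shift e φ t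
    mulG-binomial e u f φ Lf≗φ t =
      trans (mulG-+ f u (shift e f) t)
            (cong₂ (λ x y → x + u * y) (Lf≗φ t) (trans (mulG-shift e f t) (shift-cong e Lf≗φ t)))

    mulG-neg : ∀ f t → mulG (λ s → - f s) t ≡ - mulG f t
    mulG-neg f t rewrite shift-neg 1 f t | shift-neg 2 f t = by-ring (f t) (shift 1 f t) (shift 2 f t) c
      where by-ring : ∀ a b d c → - a + c * (- b) + - d ≡ - (a + c * b + d)
            by-ring = solve-∀

module Polynomials where

  open import Data.Nat as ℕ using (zero; suc; _≤_; _<_; z≤n; s≤s)
  import Data.Nat.Properties as ℕP
  open import Data.Integer using (ℤ; +_; -[1+_]; _+_; _*_; 0ℤ)
  open import Data.Integer.Properties
  open import Data.List using ([]; _∷_; map)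
  open import Data.Empty using (⊥-elim)
  open import Relation.Binary using (tri<; tri≈; tri>)
  open import Relation.Binary.PropositionalEquality
  open import Defs
  open Sequences

  coeff-+ₚ : ∀ p q k → coeff (p +ₚ q) k ≡ coeff p k + coeff q k
  coeff-+ₚ []      q       k       = sym (+-identityˡ _)
  coeff-+ₚ (a ∷ p) []      k       = sym (+-identityʳ _)
  coeff-+ₚ (a ∷ p) (b ∷ q) zero    = refl
  coeff-+ₚ (a ∷ p) (b ∷ q) (suc k) = coeff-+ₚ p q k

  coeff-map : ∀ a q k → coeff (map (a *_) q) k ≡ a * coeff q k
  coeff-map a []      k       = sym (*-zeroʳ a)
  coeff-map a (x ∷ q) zero    = refl
  coeff-map a (x ∷ q) (suc k) = coeff-map a q k

  coeff-0∷ : ∀ p k → coeff (+ 0 ∷ p) k ≡ shift 1 (coeff p) k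
  coeff-0∷ p zero    = refl
  coeff-0∷ p (suc k) = refl

  coeff-*ₚ-∷ : ∀ a p q k → coeff ((a ∷ p) *ₚ q) k ≡ a * coeff q k + shift 1 (coeff (p *ₚ q)) k
  coeff-*ₚ-∷ a p q k = trans (coeff-+ₚ (map (a *_) q) (+ 0 ∷ (p *ₚ q)) k)
                             (cong₂ _+_ (coeff-map a q k) (coeff-0∷ (p *ₚ q) k))

  quadratic : ℤ → Poly
  quadratic c = + 1 ∷ c ∷ + 1 ∷ []

  coeff-*ₚ-quadratic : ∀ c h k → coeff (quadratic c *ₚ h) k ≡ Quadratic.mulG c (coeff h) k
  coeff-*ₚ-quadratic c h k = begin
    coeff (quadratic c *ₚ h) k
      ≡⟨ coeff-*ₚ-∷ (+ 1) (c ∷ + 1 ∷ []) h k ⟩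
    + 1 * H k + shift 1 (coeff ((c ∷ + 1 ∷ []) *ₚ h)) k
      ≡⟨ cong₂ _+_ (*-identityˡ (H k)) (shift-cong 1 (λ t → coeff-*ₚ-∷ c (+ 1 ∷ []) h t) k) ⟩
    H k + shift 1 (λ t → c * H t + shift 1 (coeff ((+ 1 ∷ []) *ₚ h)) t) k
      ≡⟨ cong (λ x → H k + x) (shift-+ 1 (λ t → c * H t) _ k) ⟩
    H k + (shift 1 (λ t → c * H t) k + shift 1 (shift 1 (coeff ((+ 1 ∷ []) *ₚ h))) k)
      ≡⟨ cong₂ (λ x y → H k + (x + y)) (shift-* 1 c H k)
           (trans (shift-shift 1 1 _ k) (shift-cong 2 coeff-monic k)) ⟩
    H k + (c * shift 1 H k + shift 2 H k)
      ≡⟨ +-assoc (H k) _ _ ⟨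
    Quadratic.mulG c H k ∎
    where
    open ≡-Reasoning
    H = coeff h
    coeff-monic : ∀ t → coeff ((+ 1 ∷ []) *ₚ h) t ≡ H t
    coeff-monic t = trans (coeff-*ₚ-∷ (+ 1) [] h t) (trans (cong₂ _+_ (*-identityˡ (H t)) (shift0 t)) (+-identityʳ (H t)))
      where shift0 : ∀ t → shift 1 (λ _ → 0ℤ) t ≡ 0ℤ
            shift0 zero    = refl
            shift0 (suc t) = refl

  coeff-monomial : ∀ k c t → coeff (monomial k c) t ≡ c * δ k t
  coeff-monomial zero    c zero    = sym (*-identityʳ c)
  coeff-monomial zero    c (suc t) = sym (*-zeroʳ c)
  coeff-monomial (suc k) c zero    = sym (*-zeroʳ c)
  coeff-monomial (suc k) c (suc t) = coeff-monomial k c t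

  coeff-trinomial : ∀ n m ε ε′ t → coeff (trinomial n m ε ε′) t ≡ δ n t + ε * δ m t + ε′ * δ 0 t
  coeff-trinomial n m ε ε′ t = begin
    coeff (trinomial n m ε ε′) t
      ≡⟨ coeff-+ₚ (monomial n (+ 1)) _ t ⟩
    coeff (monomial n (+ 1)) t + coeff (monomial m ε +ₚ monomial 0 ε′) t
      ≡⟨ cong₂ _+_ (trans (coeff-monomial n (+ 1) t) (*-identityˡ _))
                   (trans (coeff-+ₚ (monomial m ε) (monomial 0 ε′) t)
                          (cong₂ _+_ (coeff-monomial m ε t) (coeff-monomial 0 ε′ t))) ⟩
    δ n t + (ε * δ m t + ε′ * δ 0 t)
      ≡⟨ +-assoc (δ n t) _ _ ⟨
    δ n t + ε * δ m t + ε′ * δ 0 t ∎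
    where open ≡-Reasoning

  coeff-consN : ∀ c p k → coeff (consN c p) k ≡ coeff (c ∷ p) k
  coeff-consN (+ zero)   []      zero    = refl
  coeff-consN (+ zero)   []      (suc k) = refl
  coeff-consN (+ zero)   (x ∷ p) k       = refl
  coeff-consN (+ suc n)  p       k       = refl
  coeff-consN -[1+ n ]   p       k       = refl

  coeff-trim : ∀ p k → coeff (trim p) k ≡ coeff p k
  coeff-trim []       k       = refl
  coeff-trim (c ∷ cs) k       = trans (coeff-consN c (trim cs) k) (tail k)
    where tail : ∀ k → coeff (c ∷ trim cs) k ≡ coeff (c ∷ cs) k
          tail zero    = refl
          tail (suc k) = coeff-trim cs k

  ≈ₚ⇒coeff : ∀ p q → p ≈ₚ q → ∀ k → coeff p k ≡ coeff q k
  ≈ₚ⇒coeff p q p≈q k = trans (sym (coeff-trim p k)) (trans (cong (λ r → coeff r k) p≈q) (coeff-trim q k))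

  coeff-≥len : ∀ p k → len p ≤ k → coeff p k ≡ 0ℤ
  coeff-≥len []      k       _         = refl
  coeff-≥len (x ∷ p) (suc k) (s≤s l≤k) = coeff-≥len p k l≤k

  consN-∷ : ∀ c x p → consN c (x ∷ p) ≡ c ∷ x ∷ p
  consN-∷ (+ zero)  x p = refl
  consN-∷ (+ suc n) x p = refl
  consN-∷ -[1+ n ]  x p = refl

  trim-last-nonzero : ∀ p L → len (trim p) ≡ suc L → coeff p L ≢ 0ℤ
  trim-last-nonzero []       L ()
  trim-last-nonzero (c ∷ cs) L eq with trim cs in trim-cs
  ... | [] = last c L eq
    where last : ∀ c L → len (consN c []) ≡ suc L → coeff (c ∷ cs) L ≢ 0ℤ
          last (+ zero)  L       ()
          last (+ suc n) zero    _ ()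
          last -[1+ n ]  zero    _ ()
  ... | x ∷ r rewrite consN-∷ c x r with eq
  ... | refl = trim-last-nonzero cs (len r) (cong len trim-cs)

  coeff-≥len-trim : ∀ p k → len (trim p) ≤ k → coeff p k ≡ 0ℤ
  coeff-≥len-trim p k l≤k = trans (sym (coeff-trim p k)) (coeff-≥len (trim p) k l≤k)

  deg-trim : ∀ p e → coeff p e ≢ 0ℤ → (∀ k → e < k → coeff p k ≡ 0ℤ) → deg (trim p) ≡ e
  deg-trim p e pₑ≢0 above with len (trim p) in eq
  ... | zero  = ⊥-elim (pₑ≢0 (coeff-≥len-trim p e (subst (_≤ e) (sym eq) z≤n)))
  ... | suc L with ℕP.<-cmp L e
  ...   | tri≈ _ L≡e _ = L≡e
  ...   | tri< L<e _ _ = ⊥-elim (pₑ≢0 (coeff-≥len-trim p e (subst (_≤ e) (sym eq) L<e)))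
  ...   | tri> _ _ e<L = ⊥-elim (trim-last-nonzero p L eq (above L e<L))

module Dilation (d′ : ℕ) where

  open import Data.Nat as ℕ using (ℕ; zero; suc; _≤_; _<_; _∸_; z≤n; s≤s)
  import Data.Nat.Properties as ℕP
  open import Data.Nat.DivMod using (_/_; _%_; m≡m%n+[m/n]*n; m%n<n)
  open import Data.Integer using (+_; _*_; 0ℤ)
  open import Data.Integer.Properties using (*-identityˡ; *-zeroˡ)
  open import Data.List using ([]; _∷_; replicate; _++_)
  open import Relation.Binary.PropositionalEquality
  open import Relation.Nullary using (yes; no)
  open import Defs using (compose; coeff)
  open Sequences

  D : ℕ
  D = suc d′

  -- dilate f t is f q when t = q D and 0 otherwise; dilate⁺ k f = x^k · dilate (f ∘ suc).
  mutual
    dilate : Seq → Seq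
    dilate f zero    = f 0
    dilate f (suc t) = dilate⁺ d′ f t

    dilate⁺ : ℕ → Seq → Seq
    dilate⁺ zero    f t       = dilate (λ u → f (suc u)) t
    dilate⁺ (suc k) f zero    = 0ℤ
    dilate⁺ (suc k) f (suc t) = dilate⁺ k f t

  mutual
    dilate-cong : ∀ {f g} → (∀ u → f u ≡ g u) → ∀ t → dilate f t ≡ dilate g t
    dilate-cong f≗g zero    = f≗g 0
    dilate-cong f≗g (suc t) = dilate⁺-cong d′ f≗g t

    dilate⁺-cong : ∀ k {f g} → (∀ u → f u ≡ g u) → ∀ t → dilate⁺ k f t ≡ dilate⁺ k g t
    dilate⁺-cong zero    f≗g t       = dilate-cong (λ u → f≗g (suc u)) t
    dilate⁺-cong (suc k) f≗g zero    = refl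
    dilate⁺-cong (suc k) f≗g (suc t) = dilate⁺-cong k f≗g t

  mutual
    dilate-zero : ∀ f → (∀ u → f (suc u) ≡ 0ℤ) → ∀ t → dilate f (suc t) ≡ 0ℤ
    dilate-zero f f≗0 t = dilate⁺-zero d′ f f≗0 t

    dilate⁺-zero : ∀ k f → (∀ u → f (suc u) ≡ 0ℤ) → ∀ t → dilate⁺ k f t ≡ 0ℤ
    dilate⁺-zero zero    f f≗0 zero    = f≗0 0
    dilate⁺-zero zero    f f≗0 (suc t) = dilate-zero _ (λ u → f≗0 (suc u)) t
    dilate⁺-zero (suc k) f f≗0 zero    = refl
    dilate⁺-zero (suc k) f f≗0 (suc t) = dilate⁺-zero k f f≗0 t

  dilate⁺-+ : ∀ k f t → dilate⁺ k f (k ℕ.+ t) ≡ dilate (λ u → f (suc u)) t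
  dilate⁺-+ zero    f t = refl
  dilate⁺-+ (suc k) f t = dilate⁺-+ k f t

  dilate⁺-< : ∀ k f t → t < k → dilate⁺ k f t ≡ 0ℤ
  dilate⁺-< (suc k) f zero    _         = refl
  dilate⁺-< (suc k) f (suc t) (s≤s t<k) = dilate⁺-< k f t t<k

  dilate-D+ : ∀ f t → dilate f (D ℕ.+ t) ≡ dilate (λ u → f (suc u)) t
  dilate-D+ f t = dilate⁺-+ d′ f t

  dilate-inside : ∀ f t → t < d′ → dilate f (suc t) ≡ 0ℤ
  dilate-inside f t t<d′ = dilate⁺-< d′ f t t<d′

  dilate-*+ : ∀ f q r → dilate f (q ℕ.* D ℕ.+ r) ≡ dilate (λ u → f (q ℕ.+ u)) r
  dilate-*+ f zero    r = refl
  dilate-*+ f (suc q) r = trans (cong (dilate f) (ℕP.+-assoc D (q ℕ.* D) r))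
                                (trans (dilate-D+ f (q ℕ.* D ℕ.+ r)) (dilate-*+ (λ u → f (suc u)) q r))

  dilate-* : ∀ f e → dilate f (e ℕ.* D) ≡ f e
  dilate-* f e = trans (cong (dilate f) (sym (ℕP.+-identityʳ (e ℕ.* D))))
                       (trans (dilate-*+ f e 0) (cong f (ℕP.+-identityʳ e)))

  dilate-> : ∀ f e → (∀ u → e < u → f u ≡ 0ℤ) → ∀ t → e ℕ.* D < t → dilate f t ≡ 0ℤ
  dilate-> f e f-vanishes t eD<t =
    trans (cong (dilate f) (trans (m≡m%n+[m/n]*n t D) (ℕP.+-comm (t % D) _)))
          (trans (dilate-*+ f (t / D) (t % D)) (at-remainder (t % D) refl))
    where
    at-remainder : ∀ r → t % D ≡ r → dilate (λ u → f (t / D ℕ.+ u)) r ≡ 0ℤ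
    at-remainder zero    t%D≡0 = f-vanishes _ (subst (e <_) (sym (ℕP.+-identityʳ (t / D))) e<t/D)
      where
      e<t/D : e < t / D
      e<t/D = ℕP.≰⇒> λ t/D≤e → ℕP.<⇒≱ eD<t
        (subst (_≤ e ℕ.* D) (sym (trans (m≡m%n+[m/n]*n t D) (cong (ℕ._+ (t / D) ℕ.* D) t%D≡0)))
               (ℕP.*-monoˡ-≤ D t/D≤e))
    at-remainder (suc r) t%D≡1+r = dilate-inside _ r (ℕP.≤-pred (subst (_< D) t%D≡1+r (m%n<n t D)))

  coeff-compose : ∀ p t → coeff (compose D p) t ≡ dilate (coeff p) t
  coeff-compose []       zero    = refl
  coeff-compose []       (suc t) = sym (dilate-zero _ (λ _ → refl) t)
  coeff-compose (c ∷ cs) zero    = refl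
  coeff-compose (c ∷ cs) (suc t) = padding d′ t
    where
    padding : ∀ k t → coeff (replicate k (+ 0) ++ compose D cs) t ≡ dilate⁺ k (coeff (c ∷ cs)) t
    padding zero    t       = coeff-compose cs t
    padding (suc k) zero    = refl
    padding (suc k) (suc t) = padding k t

  reverse-dilate : ∀ e f x → reverse (e ℕ.* D) (dilate f) x ≡ dilate (reverse e f) x
  reverse-dilate e f zero =
    trans (reverse-≤ (e ℕ.* D) (dilate f) 0 z≤n) (trans (dilate-* f e) (sym (reverse-≤ e f 0 z≤n)))
  reverse-dilate zero f (suc x) =
    trans (reverse-> 0 (dilate f) (suc x) (s≤s z≤n))
          (sym (dilate-zero (reverse 0 f) (λ u → reverse-> 0 f (suc u) (s≤s z≤n)) x))
  reverse-dilate (suc e) f (suc x) with x ℕ.<? d′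
  ... | yes x<d′ = begin
    reverse (suc e ℕ.* D) (dilate f) (suc x)
      ≡⟨ reverse-≤ (suc e ℕ.* D) (dilate f) (suc x) (s≤s (ℕP.≤-trans (ℕP.<⇒≤ x<d′) (ℕP.m≤m+n d′ _))) ⟩
    dilate f (suc e ℕ.* D ∸ suc x)
      ≡⟨ cong (dilate f) (trans (ℕP.+-∸-comm (e ℕ.* D) (ℕP.<⇒≤ x<d′)) (ℕP.+-comm (d′ ∸ x) (e ℕ.* D))) ⟩
    dilate f (e ℕ.* D ℕ.+ (d′ ∸ x))
      ≡⟨ dilate-*+ f e (d′ ∸ x) ⟩
    dilate (λ u → f (e ℕ.+ u)) (d′ ∸ x)
      ≡⟨ cong (dilate (λ u → f (e ℕ.+ u))) (ℕP.+-∸-assoc 1 x<d′) ⟩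
    dilate (λ u → f (e ℕ.+ u)) (suc (d′ ∸ suc x))
      ≡⟨ dilate-inside _ (d′ ∸ suc x) (ℕP.∸-monoʳ-< {d′} (s≤s z≤n) x<d′) ⟩
    0ℤ
      ≡⟨ dilate-inside (reverse (suc e) f) x x<d′ ⟨
    dilate (reverse (suc e) f) (suc x) ∎
    where open ≡-Reasoning
  ... | no x≮d′ = begin
    reverse (suc e ℕ.* D) (dilate f) (suc x)
      ≡⟨ cong (λ y → reverse (suc e ℕ.* D) (dilate f) (suc y)) (sym d′+y≡x) ⟩
    reverse (D ℕ.+ e ℕ.* D) (dilate f) (D ℕ.+ y)
      ≡⟨ reverse-+ D (e ℕ.* D) (dilate f) y ⟩
    reverse (e ℕ.* D) (dilate f) y
      ≡⟨ reverse-dilate e f y ⟩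
    dilate (reverse e f) y
      ≡⟨ dilate-cong (λ u → reverse-suc e f u) y ⟨
    dilate (λ u → reverse (suc e) f (suc u)) y
      ≡⟨ dilate-D+ (reverse (suc e) f) y ⟨
    dilate (reverse (suc e) f) (D ℕ.+ y)
      ≡⟨ cong (λ z → dilate (reverse (suc e) f) (suc z)) d′+y≡x ⟩
    dilate (reverse (suc e) f) (suc x) ∎
    where
    open ≡-Reasoning
    y = x ∸ d′
    d′+y≡x : d′ ℕ.+ y ≡ x
    d′+y≡x = ℕP.m+[n∸m]≡n (ℕP.≮⇒≥ x≮d′)

  shift-D-dilate : ∀ f t → shift D (dilate f) t ≡ dilate (shift 1 f) t
  shift-D-dilate f t with t ℕ.<? D
  ... | yes t<D = trans (shift-<-zero D _ t t<D) (sym (below t t<D))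
    where below : ∀ t → t < D → dilate (shift 1 f) t ≡ 0ℤ
          below zero    _         = refl
          below (suc t) (s≤s t<d′) = dilate-inside _ t t<d′
  ... | no t≮D = begin
    shift D (dilate f) t              ≡⟨ cong (shift D (dilate f)) D+t∸D≡t ⟨
    shift D (dilate f) (D ℕ.+ (t ∸ D)) ≡⟨ shift-at-+ D (dilate f) (t ∸ D) ⟩
    dilate f (t ∸ D)                  ≡⟨ dilate-D+ (shift 1 f) (t ∸ D) ⟨
    dilate (shift 1 f) (D ℕ.+ (t ∸ D)) ≡⟨ cong (dilate (shift 1 f)) D+t∸D≡t ⟩
    dilate (shift 1 f) t ∎
    where
    open ≡-Reasoning
    D+t∸D≡t : D ℕ.+ (t ∸ D) ≡ t
    D+t∸D≡t = ℕP.m+[n∸m]≡n (ℕP.≮⇒≥ t≮D)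

  shift-*D-dilate : ∀ f q t → shift (q ℕ.* D) (dilate f) t ≡ dilate (shift q f) t
  shift-*D-dilate f zero    t = refl
  shift-*D-dilate f (suc q) t = begin
    shift (D ℕ.+ q ℕ.* D) (dilate f) t    ≡⟨ shift-shift D (q ℕ.* D) (dilate f) t ⟨
    shift D (shift (q ℕ.* D) (dilate f)) t ≡⟨ shift-cong D (shift-*D-dilate f q) t ⟩
    shift D (dilate (shift q f)) t        ≡⟨ shift-D-dilate (shift q f) t ⟩
    dilate (shift 1 (shift q f)) t        ≡⟨ dilate-cong (shift-shift 1 q f) t ⟩
    dilate (shift (suc q) f) t ∎
    where open ≡-Reasoning

  shift-<D-dilate : ∀ f r q s → r < D → s < D → shift r (dilate f) (q ℕ.* D ℕ.+ s) ≡ δ r s * f q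
  shift-<D-dilate f zero    q zero    _ _ =
    trans (dilate-*+ f q 0) (trans (cong f (ℕP.+-identityʳ q)) (sym (*-identityˡ (f q))))
  shift-<D-dilate f zero    q (suc s) _ (s≤s s<d′) =
    trans (dilate-*+ f q (suc s)) (trans (dilate-inside _ s s<d′) (sym (*-zeroˡ (f q))))
  shift-<D-dilate f (suc r) zero    zero    _ _ = sym (*-zeroˡ (f 0))
  shift-<D-dilate f (suc r) q       (suc s) (s≤s r<d′) (s≤s s<d′) =
    trans (cong (shift (suc r) (dilate f)) (ℕP.+-suc (q ℕ.* D) s))
          (shift-<D-dilate f r q s (ℕP.m≤n⇒m≤1+n r<d′) (ℕP.m≤n⇒m≤1+n s<d′))
  shift-<D-dilate f (suc r) (suc q) zero    (s≤s r<d′) _ = begin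
    shift (suc r) (dilate f) (suc q ℕ.* D ℕ.+ 0) ≡⟨ cong (shift (suc r) (dilate f)) D+qD≡ ⟩
    shift r (dilate f) (q ℕ.* D ℕ.+ d′)         ≡⟨ shift-<D-dilate f r q d′ (ℕP.m≤n⇒m≤1+n r<d′) ℕP.≤-refl ⟩
    δ r d′ * f q                                ≡⟨ cong (_* f q) (δ-≢ (ℕP.<⇒≢ r<d′)) ⟩
    0ℤ * f q                                    ≡⟨ *-zeroˡ (f q) ⟩
    0ℤ                                          ≡⟨ *-zeroˡ (f (suc q)) ⟨
    δ (suc r) 0 * f (suc q) ∎
    where
    open ≡-Reasoning
    D+qD≡ : suc q ℕ.* D ℕ.+ 0 ≡ suc (q ℕ.* D ℕ.+ d′)
    D+qD≡ = trans (ℕP.+-identityʳ _) (cong suc (ℕP.+-comm d′ (q ℕ.* D)))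

  shift-dilate : ∀ f i j → shift i (dilate f) j ≡ δ (i % D) (j % D) * shift (i / D) f (j / D)
  shift-dilate f i j = begin
    shift i (dilate f) j
      ≡⟨ cong (λ k → shift k (dilate f) j) (m≡m%n+[m/n]*n i D) ⟩
    shift (i % D ℕ.+ i / D ℕ.* D) (dilate f) j
      ≡⟨ shift-shift (i % D) (i / D ℕ.* D) (dilate f) j ⟨
    shift (i % D) (shift (i / D ℕ.* D) (dilate f)) j
      ≡⟨ shift-cong (i % D) (shift-*D-dilate f (i / D)) j ⟩
    shift (i % D) (dilate (shift (i / D) f)) j
      ≡⟨ cong (shift (i % D) (dilate (shift (i / D) f))) (trans (m≡m%n+[m/n]*n j D) (ℕP.+-comm (j % D) _)) ⟩
    shift (i % D) (dilate (shift (i / D) f)) (j / D ℕ.* D ℕ.+ j % D)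
      ≡⟨ shift-<D-dilate (shift (i / D) f) (i % D) (j / D) (j % D) (m%n<n i D) (m%n<n j D) ⟩
    δ (i % D) (j % D) * shift (i / D) f (j / D) ∎
    where open ≡-Reasoning

module Determinants where

  open import Data.Nat as ℕ using (ℕ; zero; suc; _<_; _≤_; z≤n; s≤s)
  import Data.Nat.Properties as ℕP
  open import Data.Integer using (ℤ; +_; -[1+_]; -_; _+_; _*_; _^_; 0ℤ; 1ℤ)
  open import Data.Integer.Properties
  open import Data.Integer.Tactic.RingSolver using (solve-∀)
  open import Data.Fin as F using (Fin; zero; suc; toℕ; punchIn; punchOut; inject₁; fromℕ<)
  open import Data.Fin.Properties
    using (punchIn-punchOut; punchInᵢ≢i; suc-injective; punchOut-cong; punchOut-punchIn;
           toℕ-inject₁; toℕ-fromℕ<; toℕ-injective; toℕ<n)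
  open import Data.Vec.Functional using (updateAt)
  open import Data.Vec.Functional.Properties using (updateAt-updates; updateAt-minimal)
  open import Data.Empty using (⊥-elim)
  open import Function using (_∘_)
  open import Relation.Binary.PropositionalEquality
  open import Relation.Nullary using (¬_; Dec; yes; no)
  open import Relation.Unary using (Decidable)
  open import Relation.Binary using (Tri; tri<; tri≈; tri>)
  open import Defs using (sumFin; alt; det)
  open Sequences using (shift; δ; δ-sym)

  Matrix : ℕ → Set
  Matrix n = Fin n → Fin n → ℤ

  minor : ∀ {n} → Matrix (suc n) → Fin (suc n) → Matrix n
  minor M j r c = M (suc r) (punchIn j c)

  replaceRow : ∀ {n} → Matrix n → Fin n → (Fin n → ℤ) → Matrix n
  replaceRow M s w = updateAt M s (λ _ → w)

  replaceRow-≡ : ∀ {n} (M : Matrix n) s w c → replaceRow M s w s c ≡ w c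
  replaceRow-≡ M s w c = cong-app (updateAt-updates s M) c

  replaceRow-≢ : ∀ {n} (M : Matrix n) s w {r} → r ≢ s → ∀ c → replaceRow M s w r c ≡ M r c
  replaceRow-≢ M s w {r} r≢s c = cong-app (updateAt-minimal r s M r≢s) c

  sumFin-cong : ∀ n {f g : Fin n → ℤ} → (∀ i → f i ≡ g i) → sumFin n f ≡ sumFin n g
  sumFin-cong zero    f≗g = refl
  sumFin-cong (suc n) f≗g = cong₂ _+_ (f≗g zero) (sumFin-cong n (f≗g ∘ suc))

  sumFin-zero : ∀ n (f : Fin n → ℤ) → (∀ i → f i ≡ 0ℤ) → sumFin n f ≡ 0ℤ
  sumFin-zero zero    f f≗0 = refl
  sumFin-zero (suc n) f f≗0 = cong₂ _+_ (f≗0 zero) (sumFin-zero n (f ∘ suc) (f≗0 ∘ suc))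

  sumFin-+ : ∀ n (f g : Fin n → ℤ) → sumFin n (λ i → f i + g i) ≡ sumFin n f + sumFin n g
  sumFin-+ zero    f g = refl
  sumFin-+ (suc n) f g rewrite sumFin-+ n (f ∘ suc) (g ∘ suc) = by-ring (f zero) (g zero) _ _
    where by-ring : ∀ a b c d → (a + b) + (c + d) ≡ (a + c) + (b + d)
          by-ring = solve-∀

  sumFin-* : ∀ n k (f : Fin n → ℤ) → sumFin n (λ i → k * f i) ≡ k * sumFin n f
  sumFin-* zero    k f = sym (*-zeroʳ k)
  sumFin-* (suc n) k f rewrite sumFin-* n k (f ∘ suc) = sym (*-distribˡ-+ k (f zero) _)

  sumFin-neg : ∀ n (f : Fin n → ℤ) → sumFin n (λ i → - f i) ≡ - sumFin n f
  sumFin-neg zero    f = refl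
  sumFin-neg (suc n) f rewrite sumFin-neg n (f ∘ suc) = sym (neg-distrib-+ (f zero) _)

  sumFin-comm : ∀ m n (f : Fin m → Fin n → ℤ) →
    sumFin m (λ i → sumFin n (f i)) ≡ sumFin n (λ j → sumFin m (λ i → f i j))
  sumFin-comm zero    n f = sym (sumFin-zero n _ (λ _ → refl))
  sumFin-comm (suc m) n f rewrite sumFin-comm m n (f ∘ suc) =
    sym (sumFin-+ n (f zero) (λ j → sumFin m (λ i → f (suc i) j)))

  sumFin-punchIn : ∀ n j (f : Fin (suc n) → ℤ) → sumFin (suc n) f ≡ f j + sumFin n (f ∘ punchIn j)
  sumFin-punchIn n       zero    f = refl
  sumFin-punchIn (suc n) (suc j) f rewrite sumFin-punchIn n j (f ∘ suc) = by-ring (f zero) (f (suc j)) _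
    where by-ring : ∀ a b c → a + (b + c) ≡ b + (a + c)
          by-ring = solve-∀

  sumFin-toℕ-+ : ∀ a b (f : ℕ → ℤ) →
    sumFin (a ℕ.+ b) (f ∘ toℕ) ≡ sumFin a (f ∘ toℕ) + sumFin b (λ t → f (a ℕ.+ toℕ t))
  sumFin-toℕ-+ zero    b f = sym (+-identityˡ _)
  sumFin-toℕ-+ (suc a) b f = trans (cong (λ x → f 0 + x) (sumFin-toℕ-+ a b (f ∘ suc))) (sym (+-assoc (f 0) _ _))

  sumFin-δ : ∀ n a b x → a < n → sumFin n (λ ρ → δ a (toℕ ρ) * (δ (toℕ ρ) b * x)) ≡ δ a b * x
  sumFin-δ (suc n) zero b x _ =
    trans (cong₂ _+_ (*-identityˡ (δ 0 b * x)) (sumFin-zero n _ (λ ρ → *-zeroˡ (δ (suc (toℕ ρ)) b * x))))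
          (+-identityʳ _)
  sumFin-δ (suc n) (suc a) zero x _ =
    trans (cong₂ _+_ (*-zeroˡ (1ℤ * x)) (sumFin-zero n _ (λ ρ → trans (cong (δ a (toℕ ρ) *_) (*-zeroˡ x)) (*-zeroʳ (δ a (toℕ ρ))))))
          (trans (+-identityʳ _) (sym (*-zeroˡ x)))
  sumFin-δ (suc n) (suc a) (suc b) x (s≤s a<n) =
    trans (cong₂ _+_ (*-zeroˡ (δ 0 (suc b) * x)) (sumFin-δ n a b x a<n)) (+-identityˡ _)

  sumFin-δ-shift : ∀ n (f : ℕ → ℤ) k y → y < n → sumFin n (λ t → f (toℕ t) * δ (k ℕ.+ toℕ t) y) ≡ shift k f y
  sumFin-δ-shift (suc n) f zero    zero    _         =
    trans (cong₂ _+_ (*-identityʳ (f 0)) (sumFin-zero n _ (λ t → *-zeroʳ (f (suc (toℕ t)))))) (+-identityʳ (f 0))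
  sumFin-δ-shift (suc n) f zero    (suc y) (s≤s y<n) =
    trans (cong₂ _+_ (*-zeroʳ (f 0)) (sumFin-δ-shift n (f ∘ suc) 0 y y<n)) (+-identityˡ _)
  sumFin-δ-shift n       f (suc k) zero    _         = sumFin-zero n _ (λ t → *-zeroʳ (f (toℕ t)))
  sumFin-δ-shift n       f (suc k) (suc y) 1+y<n     = sumFin-δ-shift n f k y (ℕP.<-trans (ℕP.n<1+n y) 1+y<n)

  sumFin-δ-select : ∀ n (f : ℕ → ℤ) y → y < n → sumFin n (λ t → δ y (toℕ t) * f (toℕ t)) ≡ f y
  sumFin-δ-select n f y y<n =
    trans (sumFin-cong n (λ t → trans (*-comm (δ y (toℕ t)) _) (cong (f (toℕ t) *_) (δ-sym y (toℕ t)))))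
          (sumFin-δ-shift n f 0 y y<n)

  laplaceTerm : ∀ n → Matrix (suc n) → Fin (suc n) → ℤ
  laplaceTerm n M j = alt (toℕ j) * (M zero j * det n (minor M j))

  det-cong : ∀ n {M N : Matrix n} → (∀ r c → M r c ≡ N r c) → det n M ≡ det n N
  det-cong zero    M≗N = refl
  det-cong (suc n) M≗N = sumFin-cong (suc n) λ j →
    cong₂ (λ a b → alt (toℕ j) * (a * b)) (M≗N zero j) (det-cong n (λ r c → M≗N (suc r) (punchIn j c)))

  det-row-+ : ∀ n s (A B C : Matrix n) →
    (∀ r → r ≢ s → ∀ c → A r c ≡ C r c) → (∀ r → r ≢ s → ∀ c → B r c ≡ C r c) →
    (∀ c → C s c ≡ A s c + B s c) → det n C ≡ det n A + det n B
  det-row-+ (suc n) zero A B C A≗C B≗C Cₛ =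
    trans (sumFin-cong (suc n) λ j →
             trans (cong (λ x → alt (toℕ j) * (x * det n (minor C j))) (Cₛ j))
             (trans (by-ring (alt (toℕ j)) (A zero j) (B zero j) (det n (minor C j)))
                    (cong₂ _+_ (cong (λ x → alt (toℕ j) * (A zero j * x))
                                     (det-cong n (λ r c → sym (A≗C (suc r) (λ ()) (punchIn j c)))))
                               (cong (λ x → alt (toℕ j) * (B zero j * x))
                                     (det-cong n (λ r c → sym (B≗C (suc r) (λ ()) (punchIn j c))))))))
          (sumFin-+ (suc n) (laplaceTerm n A) (laplaceTerm n B))
    where by-ring : ∀ s a b d → s * ((a + b) * d) ≡ s * (a * d) + s * (b * d)
          by-ring = solve-∀
  det-row-+ (suc n) (suc s) A B C A≗C B≗C Cₛ =
    trans (sumFin-cong (suc n) λ j →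
             trans (cong (λ x → alt (toℕ j) * (C zero j * x))
                         (det-row-+ n s (minor A j) (minor B j) (minor C j)
                            (λ r r≢s c → A≗C (suc r) (r≢s ∘ suc-injective) (punchIn j c))
                            (λ r r≢s c → B≗C (suc r) (r≢s ∘ suc-injective) (punchIn j c))
                            (λ c → Cₛ (punchIn j c))))
             (trans (by-ring (alt (toℕ j)) (C zero j) (det n (minor A j)) (det n (minor B j)))
                    (cong₂ _+_ (cong (λ x → alt (toℕ j) * (x * det n (minor A j))) (sym (A≗C zero (λ ()) j)))
                               (cong (λ x → alt (toℕ j) * (x * det n (minor B j))) (sym (B≗C zero (λ ()) j))))))
          (sumFin-+ (suc n) (laplaceTerm n A) (laplaceTerm n B))
    where by-ring : ∀ s a d₁ d₂ → s * (a * (d₁ + d₂)) ≡ s * (a * d₁) + s * (a * d₂)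
          by-ring = solve-∀

  det-row-* : ∀ n s k (A C : Matrix n) →
    (∀ r → r ≢ s → ∀ c → A r c ≡ C r c) → (∀ c → C s c ≡ k * A s c) → det n C ≡ k * det n A
  det-row-* (suc n) zero k A C A≗C Cₛ =
    trans (sumFin-cong (suc n) λ j →
             trans (cong₂ (λ x y → alt (toℕ j) * (x * y)) (Cₛ j)
                          (det-cong n (λ r c → sym (A≗C (suc r) (λ ()) (punchIn j c)))))
                   (by-ring (alt (toℕ j)) k (A zero j) (det n (minor A j))))
          (sumFin-* (suc n) k (laplaceTerm n A))
    where by-ring : ∀ s k a d → s * ((k * a) * d) ≡ k * (s * (a * d))
          by-ring = solve-∀
  det-row-* (suc n) (suc s) k A C A≗C Cₛ =
    trans (sumFin-cong (suc n) λ j →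
             trans (cong₂ (λ x y → alt (toℕ j) * (x * y)) (sym (A≗C zero (λ ()) j))
                          (det-row-* n s k (minor A j) (minor C j)
                             (λ r r≢s c → A≗C (suc r) (r≢s ∘ suc-injective) (punchIn j c))
                             (λ c → Cₛ (punchIn j c))))
                   (by-ring (alt (toℕ j)) k (A zero j) (det n (minor A j))))
          (sumFin-* (suc n) k (laplaceTerm n A))
    where by-ring : ∀ s k a d → s * (a * (k * d)) ≡ k * (s * (a * d))
          by-ring = solve-∀

  det-zero-row : ∀ n (M : Matrix n) s → (∀ c → M s c ≡ 0ℤ) → det n M ≡ 0ℤ
  det-zero-row n M s Mₛ≗0 = det-row-* n s 0ℤ M M (λ _ _ _ → refl) Mₛ≗0

  det-zero-column : ∀ n (M : Matrix n) c₀ → (∀ r → M r c₀ ≡ 0ℤ) → det n M ≡ 0ℤ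
  det-zero-column (suc n) M c₀ M≗0 = sumFin-zero (suc n) _ term
    where
    term : ∀ j → alt (toℕ j) * (M zero j * det n (minor M j)) ≡ 0ℤ
    term j with j F.≟ c₀
    ... | yes refl = trans (cong (λ x → alt (toℕ j) * (x * det n (minor M j))) (M≗0 zero))
                           (*-zeroʳ (alt (toℕ j)))
    ... | no j≢c₀  = trans (cong (λ x → alt (toℕ j) * (M zero j * x))
                                  (det-zero-column n (minor M j) (punchOut j≢c₀)
                                     (λ r → trans (cong (M (suc r)) (punchIn-punchOut j≢c₀)) (M≗0 (suc r)))))
                           (trans (cong (alt (toℕ j) *_) (*-zeroʳ (M zero j))) (*-zeroʳ (alt (toℕ j))))

  punchIn-punchOut-swap : ∀ {n} (a b : Fin (suc (suc n))) (a≢b : a ≢ b) (b≢a : b ≢ a) (c : Fin n) →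
    punchIn a (punchIn (punchOut a≢b) c) ≡ punchIn b (punchIn (punchOut b≢a) c)
  punchIn-punchOut-swap zero    zero    a≢b _ c = ⊥-elim (a≢b refl)
  punchIn-punchOut-swap zero    (suc b) _   _ c = refl
  punchIn-punchOut-swap (suc a) zero    _   _ c = refl
  punchIn-punchOut-swap {suc n} (suc a) (suc b) _ _ zero = refl
  punchIn-punchOut-swap {suc n} (suc a) (suc b) a≢b b≢a (suc c) =
    cong suc (punchIn-punchOut-swap a b (a≢b ∘ cong suc) (b≢a ∘ cong suc) c)

  alt-punchOut-swap : ∀ {n} (a b : Fin (suc (suc n))) (a≢b : a ≢ b) (b≢a : b ≢ a) →
    alt (toℕ a) * alt (toℕ (punchOut a≢b)) ≡ - (alt (toℕ b) * alt (toℕ (punchOut b≢a)))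
  alt-punchOut-swap zero    zero    a≢b _ = ⊥-elim (a≢b refl)
  alt-punchOut-swap zero    (suc b) _   _ = by-ring (alt (toℕ b))
    where by-ring : ∀ x → 1ℤ * x ≡ - ((- x) * 1ℤ)
          by-ring = solve-∀
  alt-punchOut-swap (suc a) zero    _   _ = by-ring (alt (toℕ a))
    where by-ring : ∀ x → (- x) * 1ℤ ≡ - (1ℤ * x)
          by-ring = solve-∀
  alt-punchOut-swap {zero}  (suc zero) (suc zero) a≢b _ = ⊥-elim (a≢b refl)
  alt-punchOut-swap {suc n} (suc a) (suc b) a≢b b≢a =
    trans (neg-neg (alt (toℕ a)) _)
          (trans (alt-punchOut-swap a b (a≢b ∘ cong suc) (b≢a ∘ cong suc))
                 (cong -_ (sym (neg-neg (alt (toℕ b)) _))))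
    where neg-neg : ∀ x y → (- x) * (- y) ≡ x * y
          neg-neg = solve-∀

  -- Expanding along the first two rows writes det M as Σₐ Σ_b term a b; exchanging the two rows
  -- turns term a b into - term b a.
  module TwoRowExpansion {n} (M : Matrix (suc (suc n))) where

    complement : ∀ a {b} → a ≢ b → ℤ
    complement a a≢b = det n (λ r c → M (suc (suc r)) (punchIn a (punchIn (punchOut a≢b) c)))

    term : Fin (suc (suc n)) → Fin (suc (suc n)) → ℤ
    term a b with a F.≟ b
    ... | yes _   = 0ℤ
    ... | no a≢b = (alt (toℕ a) * alt (toℕ (punchOut a≢b))) * (M zero a * (M (suc zero) b * complement a a≢b))

    term-diagonal : ∀ a → term a a ≡ 0ℤ
    term-diagonal a with a F.≟ a
    ... | yes _   = refl
    ... | no a≢a = ⊥-elim (a≢a refl)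

    term-punchIn : ∀ j k → term j (punchIn j k) ≡
      (alt (toℕ j) * alt (toℕ k)) * (M zero j * (M (suc zero) (punchIn j k) * det n (λ r c → M (suc (suc r)) (punchIn j (punchIn k c)))))
    term-punchIn j k with j F.≟ punchIn j k
    ... | yes j≡ = ⊥-elim (punchInᵢ≢i j k (sym j≡))
    ... | no j≢ rewrite trans (punchOut-cong j {i≢j = j≢} refl) (punchOut-punchIn j {k}) = refl

  det-two-row-expansion : ∀ n (M : Matrix (suc (suc n))) →
    det (suc (suc n)) M ≡ sumFin (suc (suc n)) (λ a → sumFin (suc (suc n)) (TwoRowExpansion.term M a))
  det-two-row-expansion n M = sumFin-cong (suc (suc n)) λ j → sym (begin
    sumFin (suc (suc n)) (E.term j)
      ≡⟨ sumFin-punchIn (suc n) j (E.term j) ⟩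
    E.term j j + sumFin (suc n) (E.term j ∘ punchIn j)
      ≡⟨ cong₂ _+_ (E.term-diagonal j) (sumFin-cong (suc n) (λ k → trans (E.term-punchIn j k)
                     (by-ring (alt (toℕ j)) (alt (toℕ k)) (M zero j) (M (suc zero) (punchIn j k)) (minor₂ j k)))) ⟩
    0ℤ + sumFin (suc n) (λ k → (alt (toℕ j) * M zero j) * (alt (toℕ k) * (M (suc zero) (punchIn j k) * minor₂ j k)))
      ≡⟨ trans (+-identityˡ _) (sumFin-* (suc n) (alt (toℕ j) * M zero j) (laplaceTerm n (minor M j))) ⟩
    (alt (toℕ j) * M zero j) * det (suc n) (minor M j)
      ≡⟨ *-assoc (alt (toℕ j)) (M zero j) _ ⟩
    laplaceTerm (suc n) M j ∎)
    where
    open ≡-Reasoning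
    module E = TwoRowExpansion M
    minor₂ : Fin (suc (suc n)) → Fin (suc n) → ℤ
    minor₂ j k = det n (λ r c → M (suc (suc r)) (punchIn j (punchIn k c)))
    by-ring : ∀ sⱼ sₖ x y d → (sⱼ * sₖ) * (x * (y * d)) ≡ (sⱼ * x) * (sₖ * (y * d))
    by-ring = solve-∀

  det-swap₀₁ : ∀ n (M M′ : Matrix (suc (suc n))) →
    (∀ c → M′ zero c ≡ M (suc zero) c) → (∀ c → M′ (suc zero) c ≡ M zero c) →
    (∀ r c → M′ (suc (suc r)) c ≡ M (suc (suc r)) c) →
    det (suc (suc n)) M′ ≡ - det (suc (suc n)) M
  det-swap₀₁ n M M′ M′₀ M′₁ M′₂ = begin
    det m M′                                      ≡⟨ det-two-row-expansion n M′ ⟩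
    sumFin m (λ a → sumFin m (E′.term a))          ≡⟨ sumFin-cong m (λ a → sumFin-cong m (antisymmetric a)) ⟩
    sumFin m (λ a → sumFin m (λ b → - E.term b a)) ≡⟨ sumFin-cong m (λ a → sumFin-neg m (λ b → E.term b a)) ⟩
    sumFin m (λ a → - sumFin m (λ b → E.term b a)) ≡⟨ sumFin-neg m (λ a → sumFin m (λ b → E.term b a)) ⟩
    - sumFin m (λ a → sumFin m (λ b → E.term b a)) ≡⟨ cong -_ (sumFin-comm m m (λ a b → E.term b a)) ⟩
    - sumFin m (λ b → sumFin m (E.term b))         ≡⟨ cong -_ (det-two-row-expansion n M) ⟨
    - det m M ∎
    where
    open ≡-Reasoning
    m = suc (suc n)
    module E  = TwoRowExpansion M
    module E′ = TwoRowExpansion M′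
    by-ring : ∀ s y x p → (- s) * (y * (x * p)) ≡ - (s * (x * (y * p)))
    by-ring = solve-∀
    antisymmetric : ∀ a b → E′.term a b ≡ - E.term b a
    antisymmetric a b with a F.≟ b | b F.≟ a
    ... | yes _   | yes _   = refl
    ... | yes a≡b | no b≢a = ⊥-elim (b≢a (sym a≡b))
    ... | no a≢b | yes b≡a = ⊥-elim (a≢b (sym b≡a))
    ... | no a≢b | no b≢a =
      trans (cong₂ _*_ (alt-punchOut-swap a b a≢b b≢a)
                       (cong₂ (λ x t → x * t) (M′₀ a) (cong₂ _*_ (M′₁ b)
                          (det-cong n (λ r c → trans (M′₂ r _) (cong (M (suc (suc r))) (punchIn-punchOut-swap a b a≢b b≢a c)))))))
            (by-ring (alt (toℕ b) * alt (toℕ (punchOut b≢a))) (M (suc zero) a) (M zero b) (E.complement b b≢a))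

  swapAdjacent : ∀ {n} → Fin n → Fin (suc n) → Fin (suc n)
  swapAdjacent zero    zero          = suc zero
  swapAdjacent zero    (suc zero)    = zero
  swapAdjacent zero    (suc (suc r)) = suc (suc r)
  swapAdjacent (suc k) zero          = zero
  swapAdjacent (suc k) (suc r)       = suc (swapAdjacent k r)

  swapAdjacent-inject₁ : ∀ {n} (k : Fin n) → swapAdjacent k (inject₁ k) ≡ suc k
  swapAdjacent-inject₁ zero    = refl
  swapAdjacent-inject₁ (suc k) = cong suc (swapAdjacent-inject₁ k)

  det-swapAdjacent : ∀ n k (M M′ : Matrix (suc n)) → (∀ r c → M′ r c ≡ M (swapAdjacent k r) c) →
    det (suc n) M′ ≡ - det (suc n) M
  det-swapAdjacent (suc n) zero M M′ M′≗ =
    det-swap₀₁ n M M′ (M′≗ zero) (M′≗ (suc zero)) (λ r → M′≗ (suc (suc r)))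
  det-swapAdjacent (suc n) (suc k) M M′ M′≗ =
    trans (sumFin-cong (suc (suc n)) λ j →
             trans (cong₂ (λ x y → alt (toℕ j) * (x * y)) (M′≗ zero j)
                          (det-swapAdjacent n k (minor M j) (minor M′ j) (λ r c → M′≗ (suc r) (punchIn j c))))
                   (by-ring (alt (toℕ j)) (M zero j) _))
          (sumFin-neg (suc (suc n)) (laplaceTerm (suc n) M))
    where by-ring : ∀ s x d → s * (x * (- d)) ≡ - (s * (x * d))
          by-ring = solve-∀

  x≡-x⇒x≡0 : ∀ (x : ℤ) → x ≡ - x → x ≡ 0ℤ
  x≡-x⇒x≡0 (+ zero)  _ = refl
  x≡-x⇒x≡0 (+ suc n) ()
  x≡-x⇒x≡0 -[1+ n ]  ()

  det-equal-row₀ : ∀ n (M : Matrix (suc n)) j → (∀ c → M zero c ≡ M (suc j) c) → det (suc n) M ≡ 0ℤ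
  det-equal-row₀ n M j = by-distance (toℕ j) n M j refl
    where
    by-distance : ∀ t n (M : Matrix (suc n)) j → toℕ j ≡ t → (∀ c → M zero c ≡ M (suc j) c) → det (suc n) M ≡ 0ℤ
    by-distance t       (suc n) M zero    _    M₀≗ = x≡-x⇒x≡0 _ (det-swap₀₁ n M M M₀≗ (sym ∘ M₀≗) (λ _ _ → refl))
    by-distance (suc t) (suc n) M (suc j) j≡1+t M₀≗ = begin
      det (suc (suc n)) M      ≡⟨ neg-involutive _ ⟨
      - - det (suc (suc n)) M  ≡⟨ cong -_ (det-swapAdjacent (suc n) (suc j) M M′ (λ _ _ → refl)) ⟨
      - det (suc (suc n)) M′   ≡⟨ cong -_ (by-distance t (suc n) M′ (inject₁ j) (trans (toℕ-inject₁ j) (ℕP.suc-injective j≡1+t)) M′₀≗) ⟩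
      - 0ℤ ∎
      where
      open ≡-Reasoning
      M′ : Matrix (suc (suc n))
      M′ r = M (swapAdjacent (suc j) r)
      M′₀≗ : ∀ c → M′ zero c ≡ M′ (suc (inject₁ j)) c
      M′₀≗ c = trans (M₀≗ c) (cong (λ r → M r c) (sym (cong suc (swapAdjacent-inject₁ j))))

  det-equal-rows : ∀ n (M : Matrix n) i j → i ≢ j → (∀ c → M i c ≡ M j c) → det n M ≡ 0ℤ
  det-equal-rows (suc n) M zero    zero    i≢j _   = ⊥-elim (i≢j refl)
  det-equal-rows (suc n) M zero    (suc j) _   Mᵢ≗ = det-equal-row₀ n M j Mᵢ≗
  det-equal-rows (suc n) M (suc i) zero    _   Mᵢ≗ = det-equal-row₀ n M i (sym ∘ Mᵢ≗)
  det-equal-rows (suc n) M (suc i) (suc j) i≢j Mᵢ≗ =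
    sumFin-zero (suc n) _ λ k →
      trans (cong (λ x → alt (toℕ k) * (M zero k * x))
                  (det-equal-rows n (minor M k) i j (i≢j ∘ cong suc) (λ c → Mᵢ≗ (punchIn k c))))
            (by-ring (alt (toℕ k)) (M zero k))
    where by-ring : ∀ s x → s * (x * 0ℤ) ≡ 0ℤ
          by-ring = solve-∀

  det-row-sum : ∀ n m (M : Matrix n) s (v : Fin m → Fin n → ℤ) →
    det n (replaceRow M s (λ c → sumFin m (λ t → v t c))) ≡ sumFin m (λ t → det n (replaceRow M s (v t)))
  det-row-sum n zero    M s v = det-zero-row n _ s (replaceRow-≡ M s _)
  det-row-sum n (suc m) M s v =
    trans (det-row-+ n s (replaceRow M s (v zero)) (replaceRow M s (λ c → sumFin m (λ t → v (suc t) c))) _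
             (λ r r≢s c → trans (replaceRow-≢ M s _ r≢s c) (sym (replaceRow-≢ M s _ r≢s c)))
             (λ r r≢s c → trans (replaceRow-≢ M s _ r≢s c) (sym (replaceRow-≢ M s _ r≢s c)))
             (λ c → trans (replaceRow-≡ M s _ c) (sym (cong₂ _+_ (replaceRow-≡ M s _ c) (replaceRow-≡ M s _ c)))))
          (cong (λ x → det n (replaceRow M s (v zero)) + x) (det-row-sum n m M s (v ∘ suc)))

  det-add-combination : ∀ n (M : Matrix n) s κ (K : Fin n → ℤ) → K s ≡ 0ℤ →
    det n (replaceRow M s (λ c → κ * M s c + sumFin n (λ t → K t * M t c))) ≡ κ * det n M
  det-add-combination n M s κ K Kₛ≡0 = begin
    det n (replaceRow M s (λ c → κ * M s c + sumFin n (λ t → K t * M t c)))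
      ≡⟨ det-row-+ n s (replaceRow M s (λ c → κ * M s c)) (replaceRow M s (λ c → sumFin n (λ t → K t * M t c))) _
           (λ r r≢s c → trans (replaceRow-≢ M s _ r≢s c) (sym (replaceRow-≢ M s _ r≢s c)))
           (λ r r≢s c → trans (replaceRow-≢ M s _ r≢s c) (sym (replaceRow-≢ M s _ r≢s c)))
           (λ c → trans (replaceRow-≡ M s _ c) (sym (cong₂ _+_ (replaceRow-≡ M s _ c) (replaceRow-≡ M s _ c)))) ⟩
    det n (replaceRow M s (λ c → κ * M s c)) + det n (replaceRow M s (λ c → sumFin n (λ t → K t * M t c)))
      ≡⟨ cong₂ _+_ (det-row-* n s κ M _ (λ r r≢s c → sym (replaceRow-≢ M s _ r≢s c)) (replaceRow-≡ M s _))
                   (det-row-sum n n M s (λ t c → K t * M t c)) ⟩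
    κ * det n M + sumFin n (λ t → det n (replaceRow M s (λ c → K t * M t c)))
      ≡⟨ cong (λ x → κ * det n M + x) (sumFin-zero n _ other-rows) ⟩
    κ * det n M + 0ℤ
      ≡⟨ +-identityʳ _ ⟩
    κ * det n M ∎
    where
    open ≡-Reasoning
    other-rows : ∀ t → det n (replaceRow M s (λ c → K t * M t c)) ≡ 0ℤ
    other-rows t = trans (det-row-* n s (K t) (replaceRow M s (M t)) _
                            (λ r r≢s c → trans (replaceRow-≢ M s _ r≢s c) (sym (replaceRow-≢ M s _ r≢s c)))
                            (λ c → trans (replaceRow-≡ M s _ c) (sym (cong (K t *_) (replaceRow-≡ M s _ c)))))
                         (vanishes t)
      where
      vanishes : ∀ t → K t * det n (replaceRow M s (M t)) ≡ 0ℤ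
      vanishes t with t F.≟ s
      ... | yes refl = cong (_* det n (replaceRow M s (M t))) Kₛ≡0
      ... | no t≢s   = trans (cong (K t *_) (det-equal-rows n (replaceRow M s (M t)) s t (t≢s ∘ sym)
                                               (λ c → trans (replaceRow-≡ M s _ c) (sym (replaceRow-≢ M s _ t≢s c)))))
                             (*-zeroʳ (K t))

  product : ℕ → (ℕ → ℤ) → ℤ
  product zero    f = 1ℤ
  product (suc k) f = f 0 * product k (f ∘ suc)

  product-cong : ∀ k {f g} → (∀ i → i < k → f i ≡ g i) → product k f ≡ product k g
  product-cong zero    f≗g = refl
  product-cong (suc k) f≗g = cong₂ _*_ (f≗g 0 (s≤s z≤n)) (product-cong k (λ i i<k → f≗g (suc i) (s≤s i<k)))

  product-+ : ∀ a b f → product (a ℕ.+ b) f ≡ product a f * product b (λ i → f (a ℕ.+ i))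
  product-+ zero    b f = sym (*-identityˡ _)
  product-+ (suc a) b f = trans (cong (f 0 *_) (product-+ a b (f ∘ suc))) (sym (*-assoc (f 0) _ _))

  product-suc : ∀ k f → product (suc k) f ≡ product k f * f k
  product-suc k f = begin
    product (suc k) f                    ≡⟨ cong (λ m → product m f) (ℕP.+-comm 1 k) ⟩
    product (k ℕ.+ 1) f                  ≡⟨ product-+ k 1 f ⟩
    product k f * (f (k ℕ.+ 0) * 1ℤ)     ≡⟨ cong (λ x → product k f * x) (trans (*-identityʳ _) (cong f (ℕP.+-identityʳ k))) ⟩
    product k f * f k ∎
    where open ≡-Reasoning

  product-const : ∀ k x → product k (λ _ → x) ≡ x ^ k
  product-const zero    x = refl
  product-const (suc k) x = cong (x *_) (product-const k x)

  product-ones : ∀ k → product k (λ _ → 1ℤ) ≡ 1ℤ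
  product-ones k = trans (product-const k 1ℤ) (^-zeroˡ k)

  product-last : ∀ k f → (∀ i → i < k → f i ≡ 1ℤ) → product (suc k) f ≡ f k
  product-last k f f≗1 = begin
    product (suc k) f          ≡⟨ product-suc k f ⟩
    product k f * f k          ≡⟨ cong (_* f k) (trans (product-cong k f≗1) (product-ones k)) ⟩
    1ℤ * f k                   ≡⟨ *-identityˡ (f k) ⟩
    f k ∎
    where open ≡-Reasoning

  det-upper-triangular : ∀ n (m : ℕ → ℕ → ℤ) → (∀ r c → c < r → r < n → m r c ≡ 0ℤ) →
    det n (λ r c → m (toℕ r) (toℕ c)) ≡ product n (λ i → m i i)
  det-upper-triangular zero    m _ = refl
  det-upper-triangular (suc n) m below≗0 = begin
    laplaceTerm n M zero + sumFin n (laplaceTerm n M ∘ suc)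
      ≡⟨ cong (λ x → laplaceTerm n M zero + x) (sumFin-zero n _ later-columns) ⟩
    laplaceTerm n M zero + 0ℤ
      ≡⟨ +-identityʳ _ ⟩
    1ℤ * (m 0 0 * det n (minor M zero))
      ≡⟨ *-identityˡ _ ⟩
    m 0 0 * det n (minor M zero)
      ≡⟨ cong (m 0 0 *_) (det-upper-triangular n (λ r c → m (suc r) (suc c))
                            (λ r c c<r r<n → below≗0 (suc r) (suc c) (s≤s c<r) (s≤s r<n))) ⟩
    m 0 0 * product n (λ i → m (suc i) (suc i)) ∎
    where
    open ≡-Reasoning
    M : Matrix (suc n)
    M r c = m (toℕ r) (toℕ c)
    first-of : ∀ {k} → Fin k → Fin k
    first-of zero    = zero
    first-of (suc _) = zero
    punchIn-first-of : ∀ {k} (j : Fin k) → punchIn (suc j) (first-of j) ≡ zero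
    punchIn-first-of zero    = refl
    punchIn-first-of (suc j) = refl
    later-columns : ∀ j → laplaceTerm n M (suc j) ≡ 0ℤ
    later-columns j =
      trans (cong (λ x → alt (toℕ (suc j)) * (M zero (suc j) * x))
                  (det-zero-column n (minor M (suc j)) (first-of j)
                     (λ r → trans (cong (λ z → m (suc (toℕ r)) (toℕ z)) (punchIn-first-of j))
                                  (below≗0 (suc (toℕ r)) 0 (s≤s z≤n) (s≤s (toℕ<n r))))))
            (trans (cong (alt (toℕ (suc j)) *_) (*-zeroʳ (M zero (suc j)))) (*-zeroʳ (alt (toℕ (suc j)))))

  rowFactor : ∀ {Fixed : ℕ → Set} → Decidable Fixed → (ℕ → ℤ) → ℕ → ℤ
  rowFactor fixed? κ i with fixed? i
  ... | yes _ = 1ℤ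
  ... | no  _ = κ i

  rowFactor-fixed : ∀ {Fixed : ℕ → Set} (fixed? : Decidable Fixed) κ {i} → Fixed i → rowFactor fixed? κ i ≡ 1ℤ
  rowFactor-fixed fixed? κ {i} i-fixed with fixed? i
  ... | yes _       = refl
  ... | no  i-moved = ⊥-elim (i-moved i-fixed)

  rowFactor-moved : ∀ {Fixed : ℕ → Set} (fixed? : Decidable Fixed) κ {i} → ¬ Fixed i → rowFactor fixed? κ i ≡ κ i
  rowFactor-moved fixed? κ {i} i-moved with fixed? i
  ... | yes i-fixed = ⊥-elim (i-moved i-fixed)
  ... | no  _       = refl

  rowFactor-1 : ∀ {Fixed : ℕ → Set} (fixed? : Decidable Fixed) i → rowFactor fixed? (λ _ → 1ℤ) i ≡ 1ℤ
  rowFactor-1 fixed? i with fixed? i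
  ... | yes _ = refl
  ... | no  _ = refl

  rowFactor-∘ : ∀ {Fixed : ℕ → Set} (fixed? : Decidable Fixed) κ f i →
    rowFactor (fixed? ∘ f) (κ ∘ f) i ≡ rowFactor fixed? κ (f i)
  rowFactor-∘ fixed? κ f i with fixed? (f i)
  ... | yes _ = refl
  ... | no  _ = refl

  module RowOperations {n} {Fixed : ℕ → Set} (fixed? : Decidable Fixed) (κ : ℕ → ℤ) (K : Fin n → Fin n → ℤ)
    (M M′ : Matrix n)
    (M′-fixed : ∀ r → Fixed (toℕ r) → ∀ c → M′ r c ≡ M r c)
    (M′-moved : ∀ r → ¬ Fixed (toℕ r) → ∀ c → M′ r c ≡ κ (toℕ r) * M r c + sumFin n (λ t → K r t * M t c))
    (K-fixed  : ∀ r t → ¬ Fixed (toℕ t) → K r t ≡ 0ℤ)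
    where

    partial : ℕ → Matrix n
    partial k r with toℕ r ℕ.<? k
    ... | yes _ = M′ r
    ... | no  _ = M r

    partial-< : ∀ k r → toℕ r < k → ∀ c → partial k r c ≡ M′ r c
    partial-< k r r<k c with toℕ r ℕ.<? k
    ... | yes _  = refl
    ... | no r≮k = ⊥-elim (r≮k r<k)

    partial-≥ : ∀ k r → k ≤ toℕ r → ∀ c → partial k r c ≡ M r c
    partial-≥ k r k≤r c with toℕ r ℕ.<? k
    ... | yes r<k = ⊥-elim (ℕP.<⇒≱ r<k k≤r)
    ... | no  _   = refl

    partial-fixed : ∀ k t → Fixed (toℕ t) → ∀ c → partial k t c ≡ M t c
    partial-fixed k t t-fixed c with toℕ t ℕ.<? k
    ... | yes _ = M′-fixed t t-fixed c
    ... | no  _ = refl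

    module Step (k : ℕ) (k<n : k < n) where

      r₀ : Fin n
      r₀ = fromℕ< k<n

      r₀≡k : toℕ r₀ ≡ k
      r₀≡k = toℕ-fromℕ< k<n

      row-r₀ : ∀ c → partial k r₀ c ≡ M r₀ c
      row-r₀ = partial-≥ k r₀ (ℕP.≤-reflexive (sym r₀≡k))

      partial-suc : ∀ r c → partial (suc k) r c ≡ replaceRow (partial k) r₀ (M′ r₀) r c
      partial-suc r c with r F.≟ r₀
      ... | yes refl = trans (partial-< (suc k) r₀ (s≤s (ℕP.≤-reflexive r₀≡k)) c) (sym (replaceRow-≡ (partial k) r₀ _ c))
      ... | no r≢r₀ = trans (unchanged (ℕP.<-cmp (toℕ r) k)) (sym (replaceRow-≢ (partial k) r₀ _ r≢r₀ c))
        where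
        unchanged : Tri (toℕ r < k) (toℕ r ≡ k) (k < toℕ r) → partial (suc k) r c ≡ partial k r c
        unchanged (tri< r<k _ _) = trans (partial-< (suc k) r (ℕP.m<n⇒m<1+n r<k) c) (sym (partial-< k r r<k c))
        unchanged (tri≈ _ r≡k _) = ⊥-elim (r≢r₀ (toℕ-injective (trans r≡k (sym r₀≡k))))
        unchanged (tri> _ _ k<r) = trans (partial-≥ (suc k) r k<r c) (sym (partial-≥ k r (ℕP.<⇒≤ k<r) c))

      step-fixed : Fixed k → det n (replaceRow (partial k) r₀ (M′ r₀)) ≡ det n (partial k)
      step-fixed k-fixed = det-cong n unchanged
        where
        unchanged : ∀ r c → replaceRow (partial k) r₀ (M′ r₀) r c ≡ partial k r c
        unchanged r c with r F.≟ r₀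
        ... | yes refl = trans (replaceRow-≡ (partial k) r₀ _ c)
                               (trans (M′-fixed r₀ (subst Fixed (sym r₀≡k) k-fixed) c) (sym (row-r₀ c)))
        ... | no r≢r₀ = replaceRow-≢ (partial k) r₀ _ r≢r₀ c

      step-moved : ¬ Fixed k → det n (replaceRow (partial k) r₀ (M′ r₀)) ≡ κ k * det n (partial k)
      step-moved k-moved =
        trans (det-cong n combination) (det-add-combination n (partial k) r₀ (κ k) (K r₀) (K-fixed r₀ r₀ r₀-moved))
        where
        r₀-moved : ¬ Fixed (toℕ r₀)
        r₀-moved = k-moved ∘ subst Fixed r₀≡k
        via-fixed : ∀ c t → K r₀ t * M t c ≡ K r₀ t * partial k t c
        via-fixed c t with fixed? (toℕ t)
        ... | yes t-fixed = cong (K r₀ t *_) (sym (partial-fixed k t t-fixed c))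
        ... | no  t-moved = trans (cong (_* M t c) (K-fixed r₀ t t-moved)) (sym (cong (_* partial k t c) (K-fixed r₀ t t-moved)))
        combination : ∀ r c → replaceRow (partial k) r₀ (M′ r₀) r c
                            ≡ replaceRow (partial k) r₀ (λ c → κ k * partial k r₀ c + sumFin n (λ t → K r₀ t * partial k t c)) r c
        combination r c with r F.≟ r₀
        ... | no r≢r₀ = trans (replaceRow-≢ (partial k) r₀ _ r≢r₀ c) (sym (replaceRow-≢ (partial k) r₀ _ r≢r₀ c))
        ... | yes refl = trans (replaceRow-≡ (partial k) r₀ _ c)
                               (trans (M′-moved r₀ r₀-moved c)
                                      (trans (cong₂ _+_ (cong₂ _*_ (cong κ r₀≡k) (sym (row-r₀ c))) (sumFin-cong n (via-fixed c)))
                                             (sym (replaceRow-≡ (partial k) r₀ _ c))))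

    partial-step : ∀ k (k<n : k < n) → det n (partial (suc k)) ≡ rowFactor fixed? κ k * det n (partial k)
    partial-step k k<n with fixed? k
    ... | yes k-fixed = trans (det-cong n partial-suc) (trans (step-fixed k-fixed) (sym (*-identityˡ _)))
      where open Step k k<n
    ... | no  k-moved = trans (det-cong n partial-suc) (step-moved k-moved)
      where open Step k k<n

    det-partial : ∀ k → k ≤ n → det n (partial k) ≡ product k (rowFactor fixed? κ) * det n M
    det-partial zero    _       = trans (det-cong n (λ r → partial-≥ 0 r z≤n)) (sym (*-identityˡ _))
    det-partial (suc k) 1+k≤n = begin
      det n (partial (suc k))                                         ≡⟨ partial-step k 1+k≤n ⟩
      rowFactor fixed? κ k * det n (partial k)                         ≡⟨ cong (rowFactor fixed? κ k *_) (det-partial k (ℕP.<⇒≤ 1+k≤n)) ⟩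
      rowFactor fixed? κ k * (product k (rowFactor fixed? κ) * det n M) ≡⟨ by-ring (rowFactor fixed? κ k) (product k (rowFactor fixed? κ)) (det n M) ⟩
      product k (rowFactor fixed? κ) * rowFactor fixed? κ k * det n M   ≡⟨ cong (_* det n M) (product-suc k (rowFactor fixed? κ)) ⟨
      product (suc k) (rowFactor fixed? κ) * det n M ∎
      where
      open ≡-Reasoning
      by-ring : ∀ f p d → f * (p * d) ≡ p * f * d
      by-ring = solve-∀

    det-row-operations : det n M′ ≡ product n (rowFactor fixed? κ) * det n M
    det-row-operations = trans (sym (det-cong n (λ r → partial-< n r (toℕ<n r)))) (det-partial n ℕP.≤-refl)

-- The Kronecker product M ⊗ I_D, with the index of M as the slow one: i ↦ (i / D, i % D).
module Kronecker (d′ : ℕ) where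

  open import Data.Nat as ℕ using (ℕ; zero; suc; _<_)
  import Data.Nat.Properties as ℕP
  open import Data.Nat.DivMod
    using (_/_; _%_; m≡m%n+[m/n]*n; m<n*o⇒m/o<n; m%n<n; +-distrib-/; m*n%n≡0; m<n⇒m%n≡m;
           m<n⇒m/n≡0; m*n/n≡m; [m+kn]%n≡m%n; /-monoˡ-≤)
  open import Relation.Nullary using (¬_)
  open import Relation.Unary using (Decidable)
  open import Data.Integer using (ℤ; _+_; _*_; _^_; 0ℤ)
  open import Data.Integer.Properties
  open import Data.Integer.Tactic.RingSolver using (solve-∀)
  open import Data.Fin using (Fin; zero; suc; toℕ)
  open import Data.Fin.Properties using (toℕ<n)
  open import Data.Sum using (inj₁; inj₂)
  open import Function using (_∘_)
  open import Relation.Binary.PropositionalEquality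
  open import Defs using (sumFin; det)
  open Sequences using (δ; δ-refl; δ-≢)
  open Determinants

  D : ℕ
  D = suc d′

  ⊗I : (ℕ → ℕ → ℤ) → ℕ → ℕ → ℤ
  ⊗I M i j = δ (i % D) (j % D) * M (i / D) (j / D)

  det⊗I : ℕ → (ℕ → ℕ → ℤ) → ℤ
  det⊗I n M = det (n ℕ.* D) (λ r c → ⊗I M (toℕ r) (toℕ c))

  block-/ : ∀ q ρ → ρ < D → (q ℕ.* D ℕ.+ ρ) / D ≡ q
  block-/ q ρ ρ<D =
    trans (+-distrib-/ (q ℕ.* D) ρ (subst₂ (λ a b → a ℕ.+ b < D) (sym (m*n%n≡0 q D)) (sym (m<n⇒m%n≡m ρ<D)) ρ<D))
          (trans (cong₂ ℕ._+_ (m*n/n≡m q D) (m<n⇒m/n≡0 ρ<D)) (ℕP.+-identityʳ q))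

  block-% : ∀ q ρ → ρ < D → (q ℕ.* D ℕ.+ ρ) % D ≡ ρ
  block-% q ρ ρ<D = trans (cong (_% D) (ℕP.+-comm (q ℕ.* D) ρ)) (trans ([m+kn]%n≡m%n ρ q D) (m<n⇒m%n≡m ρ<D))

  sumFin-blocks : ∀ n (f : ℕ → ℤ) →
    sumFin (n ℕ.* D) (f ∘ toℕ) ≡ sumFin n (λ q → sumFin D (λ ρ → f (toℕ q ℕ.* D ℕ.+ toℕ ρ)))
  sumFin-blocks zero    f = refl
  sumFin-blocks (suc n) f =
    trans (sumFin-toℕ-+ D (n ℕ.* D) f)
          (cong (λ x → sumFin D (f ∘ toℕ) + x)
                (trans (sumFin-blocks n (λ x → f (D ℕ.+ x)))
                       (sumFin-cong n λ q → sumFin-cong D λ ρ → cong f (sym (ℕP.+-assoc D (toℕ q ℕ.* D) (toℕ ρ))))))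

  product-blocks : ∀ n (f : ℕ → ℤ) → product (n ℕ.* D) f ≡ product n (λ q → product D (λ ρ → f (q ℕ.* D ℕ.+ ρ)))
  product-blocks zero    f = refl
  product-blocks (suc n) f =
    trans (product-+ D (n ℕ.* D) f)
          (cong (product D f *_)
                (trans (product-blocks n (λ x → f (D ℕ.+ x)))
                       (product-cong n λ q _ → product-cong D λ ρ _ → cong f (sym (ℕP.+-assoc D (q ℕ.* D) ρ)))))

  product-/ : ∀ n (f : ℕ → ℤ) → product (n ℕ.* D) (f ∘ (_/ D)) ≡ product n (λ q → f q ^ D)
  product-/ n f =
    trans (product-blocks n (f ∘ (_/ D)))
          (product-cong n λ q _ → trans (product-cong D (λ ρ ρ<D → cong f (block-/ q ρ ρ<D))) (product-const D (f q)))

  sumFin-⊗I : ∀ n a b (φ : ℕ → ℤ) → a < D →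
    sumFin (n ℕ.* D) (λ t → δ a (toℕ t % D) * (δ (toℕ t % D) b * φ (toℕ t / D))) ≡ δ a b * sumFin n (φ ∘ toℕ)
  sumFin-⊗I n a b φ a<D =
    trans (sumFin-blocks n (λ x → δ a (x % D) * (δ (x % D) b * φ (x / D))))
          (trans (sumFin-cong n λ q →
                    trans (sumFin-cong D λ ρ →
                             cong₂ (λ u v → δ a u * (δ u b * φ v)) (block-% (toℕ q) (toℕ ρ) (toℕ<n ρ)) (block-/ (toℕ q) (toℕ ρ) (toℕ<n ρ)))
                          (sumFin-δ D a b (φ (toℕ q)) a<D))
                 (sumFin-* n (δ a b) (φ ∘ toℕ)))

  det⊗I-row-operations : ∀ n {Fixed : ℕ → Set} (fixed? : Decidable Fixed) (κ : ℕ → ℤ) (K M M′ : ℕ → ℕ → ℤ) →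
    (∀ x y → x < n → y < n → Fixed x → M′ x y ≡ M x y) →
    (∀ x y → x < n → y < n → ¬ Fixed x → M′ x y ≡ κ x * M x y + sumFin n (λ t → K x (toℕ t) * M (toℕ t) y)) →
    (∀ x t → x < n → t < n → ¬ Fixed t → K x t ≡ 0ℤ) →
    det⊗I n M′ ≡ product n (λ q → rowFactor fixed? κ q ^ D) * det⊗I n M
  det⊗I-row-operations n {Fixed} fixed? κ K M M′ M′-fixed M′-moved K-fixed =
    trans (RowOperations.det-row-operations (fixed? ∘ (_/ D)) (κ ∘ (_/ D))
             (λ r t → δ (toℕ r % D) (toℕ t % D) * K (toℕ r / D) (toℕ t / D))
             (λ r c → ⊗I M (toℕ r) (toℕ c)) (λ r c → ⊗I M′ (toℕ r) (toℕ c))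
             (λ r r-fixed c → cong (δ (toℕ r % D) (toℕ c % D) *_) (M′-fixed _ _ (block r) (block c) r-fixed))
             moved
             (λ r t t-moved → trans (cong (δ (toℕ r % D) (toℕ t % D) *_) (K-fixed _ _ (block r) (block t) t-moved))
                                    (*-zeroʳ (δ (toℕ r % D) (toℕ t % D)))))
          (cong (_* det⊗I n M) (trans (product-cong (n ℕ.* D) (λ i _ → rowFactor-∘ fixed? κ (_/ D) i))
                                      (product-/ n (rowFactor fixed? κ))))
    where
    block : (r : Fin (n ℕ.* D)) → toℕ r / D < n
    block r = m<n*o⇒m/o<n (toℕ<n r)
    moved : ∀ r → ¬ Fixed (toℕ r / D) → ∀ c →
      ⊗I M′ (toℕ r) (toℕ c) ≡ κ (toℕ r / D) * ⊗I M (toℕ r) (toℕ c)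
        + sumFin (n ℕ.* D) (λ t → (δ (toℕ r % D) (toℕ t % D) * K (toℕ r / D) (toℕ t / D)) * ⊗I M (toℕ t) (toℕ c))
    moved r r-moved c =
      trans (cong (δᵣ *_) (M′-moved _ _ (block r) (block c) r-moved))
            (trans (*-distribˡ-+ δᵣ _ _)
                   (cong₂ _+_ (by-ring₁ δᵣ (κ (toℕ r / D)) (M (toℕ r / D) (toℕ c / D)))
                              (sym (trans (sumFin-cong (n ℕ.* D) (λ t →
                                             by-ring₂ (δ (toℕ r % D) (toℕ t % D)) (K (toℕ r / D) (toℕ t / D))
                                                      (δ (toℕ t % D) (toℕ c % D)) (M (toℕ t / D) (toℕ c / D))))
                                          (sumFin-⊗I n (toℕ r % D) (toℕ c % D) (λ x → K (toℕ r / D) x * M x (toℕ c / D)) (m%n<n (toℕ r) D))))))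
      where
      δᵣ = δ (toℕ r % D) (toℕ c % D)
      by-ring₁ : ∀ d k m → d * (k * m) ≡ k * (d * m)
      by-ring₁ = solve-∀
      by-ring₂ : ∀ a k b m → (a * k) * (b * m) ≡ a * (b * (k * m))
      by-ring₂ = solve-∀

  det⊗I-upper-triangular : ∀ n (M : ℕ → ℕ → ℤ) → (∀ x y → y < x → x < n → M x y ≡ 0ℤ) →
    det⊗I n M ≡ product n (λ q → M q q ^ D)
  det⊗I-upper-triangular n M M-below =
    trans (det-upper-triangular (n ℕ.* D) (⊗I M) below)
          (trans (product-blocks n (λ i → ⊗I M i i))
                 (product-cong n λ q _ →
                    trans (product-cong D (λ ρ ρ<D →
                             trans (cong₂ (λ u v → δ u u * M v v) (block-% q ρ ρ<D) (block-/ q ρ ρ<D))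
                                   (trans (cong (_* M q q) (δ-refl ρ)) (*-identityˡ _))))
                          (product-const D (M q q))))
    where
    below : ∀ r c → c < r → r < n ℕ.* D → ⊗I M r c ≡ 0ℤ
    below r c c<r r<nD with ℕP.m≤n⇒m<n∨m≡n (/-monoˡ-≤ D (ℕP.<⇒≤ c<r))
    ... | inj₁ c/D<r/D = trans (cong (δ (r % D) (c % D) *_) (M-below _ _ c/D<r/D (m<n*o⇒m/o<n r<nD))) (*-zeroʳ (δ (r % D) (c % D)))
    ... | inj₂ c/D≡r/D = trans (cong (_* M (r / D) (c / D)) (δ-≢ r%D≢c%D)) (*-zeroˡ (M (r / D) (c / D)))
      where
      r%D≢c%D : r % D ≢ c % D
      r%D≢c%D r%D≡c%D = ℕP.<⇒≢ c<r (trans (m≡m%n+[m/n]*n c D)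
                          (trans (cong₂ (λ u v → u ℕ.+ v ℕ.* D) (sym r%D≡c%D) c/D≡r/D) (sym (m≡m%n+[m/n]*n r D))))

module Sylvester where

  open import Data.Nat as ℕ using (ℕ; suc; _≤_; _<_; _∸_)
  import Data.Nat.Properties as ℕP
  open import Data.Nat.DivMod using (_/_; _%_; m<n*o⇒m/o<n; m*n≤o⇒[o∸m*n]%n≡o%n; [m∸n*o]/o≡m/o∸n; m*n/n≡m; /-monoˡ-≤)
  open import Data.Integer using (ℤ; _*_)
  open import Data.Fin using (toℕ)
  open import Data.Empty using (⊥-elim)
  open import Relation.Binary.PropositionalEquality
  open import Relation.Nullary using (Dec; yes; no)
  open import Defs using (coeff; deg; shiftEntry; sylvester)
  open Sequences

  shiftEntry≡ : ∀ p e s j → shiftEntry p e s j ≡ shift s (reverse e (coeff p)) j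
  shiftEntry≡ p e s j with s ℕ.≤? j
  ... | no s≰j = sym (shift-<-zero s _ j (ℕP.≰⇒> s≰j))
  ... | yes s≤j with (j ∸ s) ℕ.≤? e
  ...   | no  j∸s≰e = sym (trans (cong (shift s _) (sym (ℕP.m+[n∸m]≡n s≤j)))
                                 (trans (shift-at-+ s _ (j ∸ s)) (reverse-> e (coeff p) (j ∸ s) (ℕP.≰⇒> j∸s≰e))))
  ...   | yes j∸s≤e = sym (trans (cong (shift s _) (sym (ℕP.m+[n∸m]≡n s≤j)))
                                 (trans (shift-at-+ s _ (j ∸ s)) (reverse-≤ e (coeff p) (j ∸ s) j∸s≤e)))

  sylvesterEntry : Seq → Seq → ℕ → ℕ → ℕ → ℕ → ℤ
  sylvesterEntry P Q a b i j with i ℕ.<? b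
  ... | yes _ = shift i (reverse a P) j
  ... | no  _ = shift (i ∸ b) (reverse b Q) j

  sylvesterEntry-< : ∀ P Q a b i j → i < b → sylvesterEntry P Q a b i j ≡ shift i (reverse a P) j
  sylvesterEntry-< P Q a b i j i<b with i ℕ.<? b
  ... | yes _  = refl
  ... | no i≮b = ⊥-elim (i≮b i<b)

  sylvesterEntry-≥ : ∀ P Q a b i j → b ≤ i → sylvesterEntry P Q a b i j ≡ shift (i ∸ b) (reverse b Q) j
  sylvesterEntry-≥ P Q a b i j b≤i with i ℕ.<? b
  ... | yes i<b = ⊥-elim (ℕP.<⇒≱ i<b b≤i)
  ... | no  _   = refl

  sylvester≡ : ∀ p q i j → sylvester p q i j ≡ sylvesterEntry (coeff p) (coeff q) (deg p) (deg q) (toℕ i) (toℕ j)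
  sylvester≡ p q i j with suc (toℕ i) ℕ.≤? deg q | toℕ i ℕ.<? deg q
  ... | yes _ | yes _   = shiftEntry≡ p (deg p) (toℕ i) (toℕ j)
  ... | no  _ | no  _   = shiftEntry≡ q (deg q) (toℕ i ∸ deg q) (toℕ j)
  ... | yes i<b | no i≮b = ⊥-elim (i≮b i<b)
  ... | no i≮b | yes i<b = ⊥-elim (i≮b i<b)

  module _ (d′ : ℕ) where
    open Dilation d′
    open Kronecker d′ using (⊗I)

    sylvesterEntry-dilate : ∀ (G H g h : Seq) a b → (∀ u → G u ≡ dilate g u) → (∀ u → H u ≡ dilate h u) → ∀ i j →
      sylvesterEntry G H (a ℕ.* D) (b ℕ.* D) i j ≡ ⊗I (sylvesterEntry g h a b) i j
    sylvesterEntry-dilate G H g h a b G≗ H≗ i j = by-block (i ℕ.<? b ℕ.* D)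
      where
      by-block : Dec (i < b ℕ.* D) → sylvesterEntry G H (a ℕ.* D) (b ℕ.* D) i j ≡ ⊗I (sylvesterEntry g h a b) i j
      by-block (yes i<bD) =
        trans (sylvesterEntry-< G H _ _ i j i<bD)
              (trans (shift-cong i (λ u → trans (reverse-cong (a ℕ.* D) G≗ u) (reverse-dilate a g u)) j)
                     (trans (shift-dilate (reverse a g) i j)
                            (cong (δ (i % D) (j % D) *_) (sym (sylvesterEntry-< g h a b (i / D) (j / D) (m<n*o⇒m/o<n i<bD))))))
      by-block (no i≮bD) =
        trans (sylvesterEntry-≥ G H _ _ i j bD≤i)
              (trans (shift-cong (i ∸ b ℕ.* D) (λ u → trans (reverse-cong (b ℕ.* D) H≗ u) (reverse-dilate b h u)) j)
                     (trans (shift-dilate (reverse b h) (i ∸ b ℕ.* D) j)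
                            (trans (cong₂ (λ x y → δ x (j % D) * shift y (reverse b h) (j / D))
                                          (m*n≤o⇒[o∸m*n]%n≡o%n b bD≤i) ([m∸n*o]/o≡m/o∸n i b D))
                                   (cong (δ (i % D) (j % D) *_) (sym (sylvesterEntry-≥ g h a b (i / D) (j / D) b≤i/D))))))
        where
        bD≤i : b ℕ.* D ≤ i
        bD≤i = ℕP.≮⇒≥ i≮bD
        b≤i/D : b ≤ i / D
        b≤i/D = ℕP.≤-trans (ℕP.≤-reflexive (sym (m*n/n≡m b D))) (/-monoˡ-≤ D bD≤i)

module Cofactors where

  open import Data.Nat as ℕ using (ℕ; suc; _≤_; _<_; _∸_; s≤s)
  import Data.Nat.Properties as ℕP
  open import Data.Integer using (ℤ; _+_; _*_; 0ℤ; 1ℤ)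
  open import Data.Integer.Properties
  open import Data.Integer.Tactic.RingSolver using (solve-∀)
  open import Relation.Binary.PropositionalEquality
  open import Defs using (Poly; coeff; len; _*ₚ_; _≈ₚ_; trinomial)
  open Sequences
  open Polynomials

  module Cofactor (c ε ε′ : ℤ) (β m₀ : ℕ) (m₀<N : m₀ < suc (suc β)) (h : Poly)
                  (g*h≈f : (quadratic c *ₚ h) ≈ₚ trinomial (suc (suc β)) m₀ ε ε′) where
    open Quadratic c

    N gap : ℕ
    N   = suc (suc β)
    gap = N ∸ m₀

    gap+m₀≡N : gap ℕ.+ m₀ ≡ N
    gap+m₀≡N = ℕP.m∸n+n≡m (ℕP.<⇒≤ m₀<N)

    H : Seq
    H = coeff h

    mulG-H : ∀ k → mulG H k ≡ δ N k + ε * δ m₀ k + ε′ * δ 0 k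
    mulG-H k = trans (sym (coeff-*ₚ-quadratic c h k))
                     (trans (≈ₚ⇒coeff (quadratic c *ₚ h) (trinomial N m₀ ε ε′) g*h≈f k) (coeff-trinomial N m₀ ε ε′ k))

    h-above : ∀ k → β < k → H k ≡ 0ℤ
    h-above = mulG-zero-tail H β (len h) (λ k → coeff-≥len h k) annihilated
      where
      annihilated : ∀ k → β < k → mulG H (2 ℕ.+ k) ≡ 0ℤ
      annihilated k β<k = trans (mulG-H (2 ℕ.+ k))
        (trans (cong₂ (λ x y → x + ε * y + ε′ * 0ℤ) (δ-≢ (ℕP.<⇒≢ β<k)) (δ-≢ m₀≢))
               (by-ring ε ε′))
        where
        m₀≢ : m₀ ≢ 2 ℕ.+ k
        m₀≢ m₀≡ = ℕP.<⇒≱ m₀<N (subst (N ≤_) (sym m₀≡) (s≤s (s≤s (ℕP.<⇒≤ β<k))))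
        by-ring : ∀ ε ε′ → 0ℤ + ε * 0ℤ + ε′ * 0ℤ ≡ 0ℤ
        by-ring = solve-∀

    h-monic : H β ≡ 1ℤ
    h-monic = begin
      H β                               ≡⟨ by-ring (H β) c ⟩
      0ℤ + c * 0ℤ + H β                 ≡⟨ cong₂ (λ x y → x + c * y + H β) (h-above N (ℕP.m≤n⇒m≤1+n (ℕP.n<1+n β))) (h-above (suc β) (ℕP.n<1+n β)) ⟨
      mulG H N                          ≡⟨ mulG-H N ⟩
      δ N N + ε * δ m₀ N + ε′ * 0ℤ       ≡⟨ cong₂ (λ x y → x + ε * y + ε′ * 0ℤ) (δ-refl N) (δ-≢ (ℕP.<⇒≢ m₀<N)) ⟩
      1ℤ + ε * 0ℤ + ε′ * 0ℤ              ≡⟨ by-ring′ ε ε′ ⟩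
      1ℤ ∎
      where
      open ≡-Reasoning
      by-ring : ∀ x c → x ≡ 0ℤ + c * 0ℤ + x
      by-ring = solve-∀
      by-ring′ : ∀ ε ε′ → 1ℤ + ε * 0ℤ + ε′ * 0ℤ ≡ 1ℤ
      by-ring′ = solve-∀

    -- The coefficients of h, read from the top, are those of (1 + ε x^gap) / g.
    reversed : Seq
    reversed t = divG (δ 0) t + ε * shift gap (divG (δ 0)) t

    mulG-reversed : ∀ t → mulG reversed t ≡ δ 0 t + ε * δ (gap ℕ.+ 0) t
    mulG-reversed t = trans (mulG-binomial gap ε (divG (δ 0)) (δ 0) (mulG-divG (δ 0)) t)
                            (cong (λ x → δ 0 t + ε * x) (shift-δ gap 0 t))

    mulG-reverse-H : ∀ t → t ≤ β → mulG (reverse β H) t ≡ δ 0 t + ε * δ (gap ℕ.+ 0) t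
    mulG-reverse-H t t≤β = begin
      mulG (reverse β H) t
        ≡⟨ mulG-reverse β H h-above t k t+k≡β ⟩
      mulG H (2 ℕ.+ k)
        ≡⟨ mulG-H (2 ℕ.+ k) ⟩
      δ β k + ε * δ m₀ (2 ℕ.+ k) + ε′ * 0ℤ
        ≡⟨ cong₂ (λ x y → x + ε * y + ε′ * 0ℤ) top middle ⟩
      δ 0 t + ε * δ (gap ℕ.+ 0) t + ε′ * 0ℤ
        ≡⟨ by-ring (δ 0 t) (ε * δ (gap ℕ.+ 0) t) ε′ ⟩
      δ 0 t + ε * δ (gap ℕ.+ 0) t ∎
      where
      open ≡-Reasoning
      k = β ∸ t
      t+k≡β : t ℕ.+ k ≡ β
      t+k≡β = ℕP.m+[n∸m]≡n t≤β
      by-ring : ∀ a b ε′ → a + b + ε′ * 0ℤ ≡ a + b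
      by-ring = solve-∀
      top : δ β k ≡ δ 0 t
      top = δ-cong-⇔ (λ β≡k → sym (ℕP.+-cancelʳ-≡ k t 0 (trans t+k≡β β≡k)))
                     (λ 0≡t → trans (sym t+k≡β) (cong (ℕ._+ k) (sym 0≡t)))
      N≡t+2+k : N ≡ t ℕ.+ (2 ℕ.+ k)
      N≡t+2+k = trans (cong (λ x → suc (suc x)) (sym t+k≡β)) (sym (trans (ℕP.+-suc t (suc k)) (cong suc (ℕP.+-suc t k))))
      middle : δ m₀ (2 ℕ.+ k) ≡ δ (gap ℕ.+ 0) t
      middle = δ-cong-⇔
        (λ m₀≡ → trans (ℕP.+-identityʳ gap) (ℕP.+-cancelʳ-≡ m₀ gap t (trans gap+m₀≡N (trans N≡t+2+k (cong (t ℕ.+_) (sym m₀≡))))))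
        (λ gap+0≡t → ℕP.+-cancelˡ-≡ gap m₀ (2 ℕ.+ k)
                       (trans gap+m₀≡N (trans N≡t+2+k (cong (ℕ._+ (2 ℕ.+ k)) (trans (sym gap+0≡t) (ℕP.+-identityʳ gap))))))

    h-reversed : ∀ t → t ≤ β → reverse β H t ≡ reversed t
    h-reversed t t≤β = mulG-injective-< (reverse β H) reversed (suc β)
      (λ u u<1+β → trans (mulG-reverse-H u (ℕP.≤-pred u<1+β)) (sym (mulG-reversed u))) t (s≤s t≤β)

module Reduction where

  open import Data.Nat as ℕ using (ℕ; zero; suc; _≤_; _<_; _∸_; z≤n; s≤s)
  import Data.Nat.Properties as ℕP
  open import Data.Integer using (ℤ; -_; _+_; _*_; _-_; _^_; 0ℤ; 1ℤ; _≟_; ≢-nonZero)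
  open import Data.Integer.Properties
  open import Data.Integer.Tactic.RingSolver using (solve-∀)
  open import Data.Fin using (Fin; toℕ)
  open import Data.Empty using (⊥-elim)
  open import Data.Sum using (inj₁; inj₂)
  open import Relation.Binary using (tri<; tri≈; tri>)
  open import Function using (_∘_)
  open import Relation.Binary.PropositionalEquality
  open import Relation.Nullary using (¬_; Dec; yes; no)
  open import Relation.Nullary.Decidable using (¬?; decidable-stable)
  open import Defs using (sumFin)
  open Sequences
  open Determinants
  open Sylvester

  -- The norm form of ℤ[x] / (1 + c x + x²).
  norm : ℤ → ℤ → ℤ → ℤ
  norm c x y = x * x + c * x * y + y * y
  {-# INLINE norm #-}

  module _ (c : ℤ) where
    open Quadratic c

    sumFin-mulG : ∀ n a y → y < n → sumFin n (λ t → a (toℕ t) * mulG (δ (toℕ t)) y) ≡ mulG a y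
    sumFin-mulG n a y y<n = begin
      sumFin n (λ t → a (toℕ t) * mulG (δ (toℕ t)) y)
        ≡⟨ sumFin-cong n (λ t → row t) ⟩
      sumFin n (λ t → (A t + c * B t) + C t)
        ≡⟨ sumFin-+ n (λ t → A t + c * B t) C ⟩
      sumFin n (λ t → A t + c * B t) + sumFin n C
        ≡⟨ cong (_+ sumFin n C) (trans (sumFin-+ n A (λ t → c * B t)) (cong (sumFin n A +_) (sumFin-* n c B))) ⟩
      sumFin n A + c * sumFin n B + sumFin n C
        ≡⟨ cong₂ (λ u v → u + c * v + sumFin n C) (sumFin-δ-shift n a 0 y y<n) (sumFin-δ-shift n a 1 y y<n) ⟩
      a y + c * shift 1 a y + sumFin n C
        ≡⟨ cong (λ u → a y + c * shift 1 a y + u) (sumFin-δ-shift n a 2 y y<n) ⟩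
      mulG a y ∎
      where
      open ≡-Reasoning
      A B C : Fin n → ℤ
      A t = a (toℕ t) * δ (toℕ t) y
      B t = a (toℕ t) * δ (1 ℕ.+ toℕ t) y
      C t = a (toℕ t) * δ (2 ℕ.+ toℕ t) y
      row : ∀ t → a (toℕ t) * mulG (δ (toℕ t)) y ≡ (A t + c * B t) + C t
      row t rewrite shift-δ 1 (toℕ t) y | shift-δ 2 (toℕ t) y =
        by-ring (a (toℕ t)) (δ (toℕ t) y) (δ (suc (toℕ t)) y) (δ (suc (suc (toℕ t))) y) c
        where by-ring : ∀ x p q r c → x * (p + c * q + r) ≡ (x * p + c * (x * q)) + x * r
              by-ring = solve-∀

  -- Subtracting multiples of the g-rows clears the first β columns of the two ĥ-rows and leaves the
  -- block [[p₀, -p₁], [p₁, p₀ + c p₁]], of determinant p₀² + c p₀ p₁ + p₁²; integral row operations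
  -- then triangularise it at the cost of a factor α, which is cancelled at the end.
  module SylvesterReduction (d′ : ℕ) (c : ℤ) (β : ℕ) (ĝ ĥ E : Seq)
    (g-reversed : ∀ t → reverse 2 ĝ t ≡ Quadratic.mulG c (δ 0) t)
    (h-reversed : ∀ t → t ≤ β → reverse β ĥ t ≡ Quadratic.mulG c E t)
    where
    open Quadratic c
    open Kronecker d′

    n : ℕ
    n = suc (suc β)

    p₀ p₁ resultant : ℤ
    p₀ = E β
    p₁ = shift 1 E β
    resultant = norm c p₀ p₁

    S₀ : ℕ → ℕ → ℤ
    S₀ = sylvesterEntry ĝ ĥ 2 β

    S₀-top : ∀ x y → x < β → S₀ x y ≡ mulG (δ x) y
    S₀-top x y x<β = begin
      S₀ x y                     ≡⟨ sylvesterEntry-< ĝ ĥ 2 β x y x<β ⟩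
      shift x (reverse 2 ĝ) y    ≡⟨ shift-cong x g-reversed y ⟩
      shift x (mulG (δ 0)) y     ≡⟨ mulG-shift x (δ 0) y ⟨
      mulG (shift x (δ 0)) y     ≡⟨ mulG-agree _ _ y (λ u _ → trans (shift-δ x 0 u) (cong (λ k → δ k u) (ℕP.+-identityʳ x))) ⟩
      mulG (δ x) y ∎
      where open ≡-Reasoning

    S₀-bottom : ∀ x y → β ≤ x → S₀ x y ≡ shift (x ∸ β) (reverse β ĥ) y
    S₀-bottom x y = sylvesterEntry-≥ ĝ ĥ 2 β x y

    truncated : ℕ → Seq
    truncated κ t with t ℕ.<? β
    ... | yes _ = shift κ E t
    ... | no  _ = 0ℤ

    truncated-< : ∀ κ t → t < β → truncated κ t ≡ shift κ E t
    truncated-< κ t t<β with t ℕ.<? β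
    ... | yes _   = refl
    ... | no  t≮β = ⊥-elim (t≮β t<β)

    truncated-≥ : ∀ κ t → β ≤ t → truncated κ t ≡ 0ℤ
    truncated-≥ κ t β≤t with t ℕ.<? β
    ... | yes t<β = ⊥-elim (ℕP.<⇒≱ t<β β≤t)
    ... | no  _   = refl

    shift-truncated : ∀ κ k y → y < β ℕ.+ k → shift k (truncated κ) y ≡ shift k (shift κ E) y
    shift-truncated κ zero    y       y<β   = truncated-< κ y (subst (y <_) (ℕP.+-identityʳ β) y<β)
    shift-truncated κ (suc k) zero    _     = refl
    shift-truncated κ (suc k) (suc y) y<β+k =
      shift-truncated κ k y (ℕP.≤-pred (subst (suc (suc y) ≤_) (ℕP.+-suc β k) y<β+k))

    W : ℕ → Seq
    W κ y = shift κ (reverse β ĥ) y - mulG (truncated κ) y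

    W-< : ∀ κ y → y < β → W κ y ≡ 0ℤ
    W-< κ y y<β = trans (cong₂ _-_ (trans (shift-cong-≤ κ β h-reversed y (ℕP.<⇒≤ y<β)) (sym (mulG-shift κ E y)))
                                   (mulG-agree (truncated κ) (shift κ E) y (λ u u≤y → truncated-< κ u (ℕP.≤-<-trans u≤y y<β))))
                        (+-inverseʳ (mulG (shift κ E) y))

    W₀-β : W 0 β ≡ p₀
    W₀-β = trans (cong₂ _-_ (h-reversed β ℕP.≤-refl) tail) (by-ring p₀ (shift 1 E β) (shift 2 E β) c)
      where
      tail : mulG (truncated 0) β ≡ 0ℤ + c * shift 1 E β + shift 2 E β
      tail = cong₂ _+_ (cong₂ (λ u v → u + c * v) (truncated-≥ 0 β ℕP.≤-refl) (shift-truncated 0 1 β (ℕP.m<m+n β (s≤s z≤n))))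
                       (shift-truncated 0 2 β (ℕP.m<m+n β (s≤s z≤n)))
      by-ring : ∀ a b d c → (a + c * b + d) - (0ℤ + c * b + d) ≡ a
      by-ring = solve-∀

    W₀-1+β : W 0 (suc β) ≡ - p₁
    W₀-1+β = trans (cong₂ _-_ (reverse-> β ĥ (suc β) ℕP.≤-refl) tail) (by-ring p₁ c)
      where
      tail : mulG (truncated 0) (suc β) ≡ 0ℤ + c * 0ℤ + p₁
      tail = cong₂ _+_ (cong₂ (λ u v → u + c * v) (truncated-≥ 0 (suc β) (ℕP.n≤1+n β)) (truncated-≥ 0 β ℕP.≤-refl))
                       (shift-truncated 0 1 β (ℕP.m<m+n β (s≤s z≤n)))
      by-ring : ∀ b c → 0ℤ - (0ℤ + c * 0ℤ + b) ≡ - b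
      by-ring = solve-∀

    W₁-β : W 1 β ≡ p₁
    W₁-β = trans (cong₂ _-_ (trans (shift-cong-≤ 1 β h-reversed β ℕP.≤-refl) (sym (mulG-shift 1 E β))) tail)
                 (by-ring p₁ (shift 1 (shift 1 E) β) (shift 2 (shift 1 E) β) c)
      where
      tail : mulG (truncated 1) β ≡ 0ℤ + c * shift 1 (shift 1 E) β + shift 2 (shift 1 E) β
      tail = cong₂ _+_ (cong₂ (λ u v → u + c * v) (truncated-≥ 1 β ℕP.≤-refl) (shift-truncated 1 1 β (ℕP.m<m+n β (s≤s z≤n))))
                       (shift-truncated 1 2 β (ℕP.m<m+n β (s≤s z≤n)))
      by-ring : ∀ a b d c → (a + c * b + d) - (0ℤ + c * b + d) ≡ a
      by-ring = solve-∀

    W₁-1+β : W 1 (suc β) ≡ p₀ + c * p₁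
    W₁-1+β = trans (cong₂ _-_ (h-reversed β ℕP.≤-refl) tail) (by-ring p₀ p₁ (shift 2 E β) c)
      where
      tail : mulG (truncated 1) (suc β) ≡ 0ℤ + c * 0ℤ + shift 2 E β
      tail = cong₂ _+_ (cong₂ (λ u v → u + c * v) (truncated-≥ 1 (suc β) (ℕP.n≤1+n β)) (truncated-≥ 1 β ℕP.≤-refl))
                       (trans (shift-truncated 1 1 β (ℕP.m<m+n β (s≤s z≤n))) (shift-shift 1 1 E β))
      by-ring : ∀ a b d c → (a + c * b + d) - (0ℤ + c * 0ℤ + d) ≡ a + c * b
      by-ring = solve-∀

    S₁ : ℕ → ℕ → ℤ
    S₁ x y with x ℕ.<? β
    ... | yes _ = S₀ x y
    ... | no  _ = W (x ∸ β) y

    S₁-top : ∀ x y → x < β → S₁ x y ≡ S₀ x y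
    S₁-top x y x<β with x ℕ.<? β
    ... | yes _   = sylvesterEntry-< ĝ ĥ 2 β x y x<β
    ... | no  x≮β = ⊥-elim (x≮β x<β)

    S₁-bottom : ∀ x y → ¬ x < β → S₁ x y ≡ W (x ∸ β) y
    S₁-bottom x y x≮β with x ℕ.<? β
    ... | yes x<β = ⊥-elim (x≮β x<β)
    ... | no  _   = refl

    det⊗I-S₁ : det⊗I n S₁ ≡ det⊗I n S₀
    det⊗I-S₁ = begin
      det⊗I n S₁
        ≡⟨ det⊗I-row-operations n (ℕ._<? β) (λ _ → 1ℤ) K S₀ S₁ (λ x y _ _ → S₁-top x y) moved (λ x t _ _ → K-top x t) ⟩
      product n (λ q → rowFactor (ℕ._<? β) (λ _ → 1ℤ) q ^ D) * det⊗I n S₀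
        ≡⟨ cong (_* det⊗I n S₀) (trans (product-cong n (λ q _ → trans (cong (_^ D) (rowFactor-1 (ℕ._<? β) q)) (^-zeroˡ D)))
                                        (product-ones n)) ⟩
      1ℤ * det⊗I n S₀
        ≡⟨ *-identityˡ _ ⟩
      det⊗I n S₀ ∎
      where
      open ≡-Reasoning
      K : ℕ → ℕ → ℤ
      K x t = - truncated (x ∸ β) t
      K-top : ∀ x t → ¬ t < β → K x t ≡ 0ℤ
      K-top x t t≮β = cong -_ (truncated-≥ (x ∸ β) t (ℕP.≮⇒≥ t≮β))
      via-rows : ∀ κ y → y < n → ∀ t → K (β ℕ.+ κ) t * S₀ t y ≡ (- truncated κ t) * mulG (δ t) y
      via-rows κ y _ t = by-column (t ℕ.<? β)
        where
        by-column : Dec (t < β) → K (β ℕ.+ κ) t * S₀ t y ≡ (- truncated κ t) * mulG (δ t) y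
        by-column (yes t<β) = cong₂ (λ k s → (- truncated k t) * s) (ℕP.m+n∸m≡n β κ) (S₀-top t y t<β)
        by-column (no  t≮β) = trans (cong (_* S₀ t y) (K-top (β ℕ.+ κ) t t≮β))
          (trans (*-zeroˡ (S₀ t y))
                 (sym (trans (cong (λ z → (- z) * mulG (δ t) y) (truncated-≥ κ t (ℕP.≮⇒≥ t≮β))) (*-zeroˡ (mulG (δ t) y)))))
      moved : ∀ x y → x < n → y < n → ¬ x < β → S₁ x y ≡ 1ℤ * S₀ x y + sumFin n (λ t → K x (toℕ t) * S₀ (toℕ t) y)
      moved x y _ y<n x≮β = begin
        S₁ x y
          ≡⟨ S₁-bottom x y x≮β ⟩
        shift κ (reverse β ĥ) y + - mulG (truncated κ) y
          ≡⟨ cong₂ _+_ (trans (sym (S₀-bottom x y β≤x)) (sym (*-identityˡ _)))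
                       (sym (trans (cong (λ z → sumFin n (λ t → K z (toℕ t) * S₀ (toℕ t) y)) (sym β+κ≡x))
                                   (trans (sumFin-cong n (λ t → via-rows κ y y<n (toℕ t)))
                                          (trans (sumFin-mulG c n (λ t → - truncated κ t) y y<n)
                                                 (mulG-neg (truncated κ) y))))) ⟩
        1ℤ * S₀ x y + sumFin n (λ t → K x (toℕ t) * S₀ (toℕ t) y) ∎
        where
        β≤x = ℕP.≮⇒≥ x≮β
        κ = x ∸ β
        β+κ≡x : β ℕ.+ κ ≡ x
        β+κ≡x = ℕP.m+[n∸m]≡n β≤x

    S₁-β : ∀ y → S₁ β y ≡ W 0 y
    S₁-β y = trans (S₁-bottom β y (ℕP.<-irrefl refl)) (cong (λ k → W k y) (ℕP.n∸n≡0 β))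

    S₁-1+β : ∀ y → S₁ (suc β) y ≡ W 1 y
    S₁-1+β y = trans (S₁-bottom (suc β) y (ℕP.<⇒≯ (ℕP.n<1+n β))) (cong (λ k → W k y) (ℕP.m+n∸n≡m 1 β))

    mulG-δ-< : ∀ x y → y < x → mulG (δ x) y ≡ 0ℤ
    mulG-δ-< x y y<x rewrite shift-δ 1 x y | shift-δ 2 x y
      | δ-≢ (ℕP.<⇒≢ y<x ∘ sym) | δ-≢ {suc x} {y} (ℕP.<⇒≢ (ℕP.m<n⇒m<1+n y<x) ∘ sym)
      | δ-≢ {suc (suc x)} {y} (ℕP.<⇒≢ (ℕP.m<n⇒m<1+n (ℕP.m<n⇒m<1+n y<x)) ∘ sym) = by-ring c
      where by-ring : ∀ c → 0ℤ + c * 0ℤ + 0ℤ ≡ 0ℤ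
            by-ring = solve-∀

    -- τ is chosen so that the pivot α is nonzero.
    module Pivot (τ : ℤ) where

      α : ℤ
      α = p₀ + τ * p₁

      pivotRow lastRow : Seq
      pivotRow y = W 0 y + τ * W 1 y
      lastRow  y = α * W 1 y - p₁ * pivotRow y

      S₂ : ℕ → ℕ → ℤ
      S₂ x y with x ℕ.≟ β
      ... | yes _ = pivotRow y
      ... | no  _ = S₁ x y

      S₂-β : ∀ y → S₂ β y ≡ pivotRow y
      S₂-β y with β ℕ.≟ β
      ... | yes _   = refl
      ... | no  β≢β = ⊥-elim (β≢β refl)

      S₂-≢ : ∀ x y → x ≢ β → S₂ x y ≡ S₁ x y
      S₂-≢ x y x≢β with x ℕ.≟ β
      ... | yes x≡β = ⊥-elim (x≢β x≡β)
      ... | no  _   = refl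

      S₃ : ℕ → ℕ → ℤ
      S₃ x y with x ℕ.≟ suc β
      ... | yes _ = lastRow y
      ... | no  _ = S₂ x y

      S₃-1+β : ∀ y → S₃ (suc β) y ≡ lastRow y
      S₃-1+β y with suc β ℕ.≟ suc β
      ... | yes _ = refl
      ... | no  ≢ = ⊥-elim (≢ refl)

      S₃-≢ : ∀ x y → x ≢ suc β → S₃ x y ≡ S₂ x y
      S₃-≢ x y x≢1+β with x ℕ.≟ suc β
      ... | yes x≡1+β = ⊥-elim (x≢1+β x≡1+β)
      ... | no  _     = refl

      ≢? : ∀ k x → Dec (x ≢ k)
      ≢? k x = ¬? (x ℕ.≟ k)

      β≢1+β : β ≢ suc β
      β≢1+β = ℕP.<⇒≢ (ℕP.n<1+n β)

      det⊗I-S₂ : det⊗I n S₂ ≡ det⊗I n S₁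
      det⊗I-S₂ = begin
        det⊗I n S₂
          ≡⟨ det⊗I-row-operations n (≢? β) (λ _ → 1ℤ) K S₁ S₂ (λ x y _ _ → S₂-≢ x y) moved K-moved ⟩
        product n (λ q → rowFactor (≢? β) (λ _ → 1ℤ) q ^ D) * det⊗I n S₁
          ≡⟨ cong (_* det⊗I n S₁) (trans (product-cong n (λ q _ → trans (cong (_^ D) (rowFactor-1 (≢? β) q)) (^-zeroˡ D)))
                                          (product-ones n)) ⟩
        1ℤ * det⊗I n S₁
          ≡⟨ *-identityˡ _ ⟩
        det⊗I n S₁ ∎
        where
        open ≡-Reasoning
        K : ℕ → ℕ → ℤ
        K x t = τ * δ (suc β) t
        K-moved : ∀ x t → x < n → t < n → ¬ t ≢ β → K x t ≡ 0ℤ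
        K-moved x t _ _ t≡β with decidable-stable (t ℕ.≟ β) t≡β
        ... | refl = trans (cong (τ *_) (δ-≢ (β≢1+β ∘ sym))) (*-zeroʳ τ)
        moved : ∀ x y → x < n → y < n → ¬ x ≢ β → S₂ x y ≡ 1ℤ * S₁ x y + sumFin n (λ t → K x (toℕ t) * S₁ (toℕ t) y)
        moved x y _ y<n x≡β with decidable-stable (x ℕ.≟ β) x≡β
        ... | refl = begin
          S₂ β y
            ≡⟨ S₂-β y ⟩
          W 0 y + τ * W 1 y
            ≡⟨ cong₂ _+_ (trans (sym (S₁-β y)) (sym (*-identityˡ _)))
                         (sym (trans (sumFin-cong n (λ t → *-assoc τ (δ (suc β) (toℕ t)) (S₁ (toℕ t) y)))
                                     (trans (sumFin-* n τ (λ t → δ (suc β) (toℕ t) * S₁ (toℕ t) y))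
                                            (cong (τ *_) (trans (sumFin-δ-select n (λ t → S₁ t y) (suc β) (ℕP.n<1+n (suc β)))
                                                                (S₁-1+β y)))))) ⟩
          1ℤ * S₁ β y + sumFin n (λ t → K β (toℕ t) * S₁ (toℕ t) y) ∎

      det⊗I-S₃ : det⊗I n S₃ ≡ α ^ D * det⊗I n S₂
      det⊗I-S₃ = begin
        det⊗I n S₃
          ≡⟨ det⊗I-row-operations n (≢? (suc β)) (λ _ → α) K S₂ S₃ (λ x y _ _ → S₃-≢ x y) moved K-moved ⟩
        product n (λ q → rowFactor (≢? (suc β)) (λ _ → α) q ^ D) * det⊗I n S₂
          ≡⟨ cong (_* det⊗I n S₂) (trans (product-last (suc β) (λ q → rowFactor (≢? (suc β)) (λ _ → α) q ^ D) (λ q q<1+β →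
                                            trans (cong (_^ D) (rowFactor-fixed (≢? (suc β)) (λ _ → α) (ℕP.<⇒≢ q<1+β))) (^-zeroˡ D)))
                                          (cong (_^ D) (rowFactor-moved (≢? (suc β)) (λ _ → α) (λ ≢ → ≢ refl)))) ⟩
        α ^ D * det⊗I n S₂ ∎
        where
        open ≡-Reasoning
        K : ℕ → ℕ → ℤ
        K x t = - p₁ * δ β t
        K-moved : ∀ x t → x < n → t < n → ¬ t ≢ suc β → K x t ≡ 0ℤ
        K-moved x t _ _ t≡1+β with decidable-stable (t ℕ.≟ suc β) t≡1+β
        ... | refl = trans (cong (- p₁ *_) (δ-≢ β≢1+β)) (*-zeroʳ (- p₁))
        moved : ∀ x y → x < n → y < n → ¬ x ≢ suc β → S₃ x y ≡ α * S₂ x y + sumFin n (λ t → K x (toℕ t) * S₂ (toℕ t) y)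
        moved x y _ y<n x≡1+β with decidable-stable (x ℕ.≟ suc β) x≡1+β
        ... | refl = begin
          S₃ (suc β) y
            ≡⟨ S₃-1+β y ⟩
          α * W 1 y - p₁ * pivotRow y
            ≡⟨ cong₂ _+_ (cong (α *_) (trans (sym (S₁-1+β y)) (sym (S₂-≢ (suc β) y (β≢1+β ∘ sym)))))
                         (trans (neg-distribˡ-* p₁ (pivotRow y))
                                (sym (trans (sumFin-cong n (λ t → *-assoc (- p₁) (δ β (toℕ t)) (S₂ (toℕ t) y)))
                                            (trans (sumFin-* n (- p₁) (λ t → δ β (toℕ t) * S₂ (toℕ t) y))
                                                   (cong (- p₁ *_) (trans (sumFin-δ-select n (λ t → S₂ t y) β (ℕP.m<n⇒m<1+n (ℕP.n<1+n β)))
                                                                          (S₂-β y))))))) ⟩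
          α * S₂ (suc β) y + sumFin n (λ t → K (suc β) (toℕ t) * S₂ (toℕ t) y) ∎

      S₃-top : ∀ x y → x < β → S₃ x y ≡ mulG (δ x) y
      S₃-top x y x<β = trans (S₃-≢ x y (ℕP.<⇒≢ (ℕP.m<n⇒m<1+n x<β)))
                             (trans (S₂-≢ x y (ℕP.<⇒≢ x<β)) (trans (S₁-top x y x<β) (S₀-top x y x<β)))

      S₃-β : ∀ y → S₃ β y ≡ pivotRow y
      S₃-β y = trans (S₃-≢ β y β≢1+β) (S₂-β y)

      pivotRow-< : ∀ y → y < β → pivotRow y ≡ 0ℤ
      pivotRow-< y y<β = trans (cong₂ (λ u v → u + τ * v) (W-< 0 y y<β) (W-< 1 y y<β)) (by-ring τ)
        where by-ring : ∀ τ → 0ℤ + τ * 0ℤ ≡ 0ℤ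
              by-ring = solve-∀

      pivotRow-β : pivotRow β ≡ α
      pivotRow-β = cong₂ (λ u v → u + τ * v) W₀-β W₁-β

      S₃-upper : ∀ x y → y < x → x < n → S₃ x y ≡ 0ℤ
      S₃-upper x y y<x x<n with ℕP.<-cmp x β
      ... | tri< x<β _ _ = trans (S₃-top x y x<β) (mulG-δ-< x y y<x)
      ... | tri≈ _ refl _ = trans (S₃-β y) (pivotRow-< y y<x)
      ... | tri> _ _ β<x with ℕP.≤-antisym (ℕP.≤-pred x<n) β<x
      ...   | refl with ℕP.m≤n⇒m<n∨m≡n (ℕP.≤-pred y<x)
      ...     | inj₁ y<β = trans (S₃-1+β y)
                                 (trans (cong₂ (λ u v → α * u - p₁ * v) (W-< 1 y y<β) (pivotRow-< y y<β)) (by-ring α p₁))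
        where by-ring : ∀ α p → α * 0ℤ - p * 0ℤ ≡ 0ℤ
              by-ring = solve-∀
      ...     | inj₂ refl = trans (S₃-1+β β) (trans (cong₂ (λ u v → α * u - p₁ * v) W₁-β pivotRow-β) (by-ring α p₁))
        where by-ring : ∀ α p → α * p - p * α ≡ 0ℤ
              by-ring = solve-∀

      S₃-diagonal : product n (λ q → S₃ q q ^ D) ≡ α ^ D * resultant ^ D
      S₃-diagonal = begin
        product n (λ q → S₃ q q ^ D)
          ≡⟨ product-suc (suc β) (λ q → S₃ q q ^ D) ⟩
        product (suc β) (λ q → S₃ q q ^ D) * S₃ (suc β) (suc β) ^ D
          ≡⟨ cong₂ (λ u v → u * v ^ D) (product-last β (λ q → S₃ q q ^ D) (λ q q<β → trans (cong (_^ D) (trans (S₃-top q q q<β) (unit {q}))) (^-zeroˡ D)))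
                                      (trans (S₃-1+β (suc β)) corner) ⟩
        S₃ β β ^ D * resultant ^ D
          ≡⟨ cong (λ u → u ^ D * resultant ^ D) (trans (S₃-β β) pivotRow-β) ⟩
        α ^ D * resultant ^ D ∎
        where
        open ≡-Reasoning
        unit : ∀ {q} → mulG (δ q) q ≡ 1ℤ
        unit {q} rewrite shift-δ 1 q q | shift-δ 2 q q | δ-refl q
                       | δ-≢ {suc q} {q} (ℕP.<⇒≢ (ℕP.n<1+n q) ∘ sym)
                       | δ-≢ {suc (suc q)} {q} (ℕP.<⇒≢ (ℕP.m<n⇒m<1+n (ℕP.n<1+n q)) ∘ sym) = by-ring c
          where by-ring : ∀ c → 1ℤ + c * 0ℤ + 0ℤ ≡ 1ℤ
                by-ring = solve-∀
        corner : lastRow (suc β) ≡ resultant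
        corner = trans (cong₂ (λ u v → α * u - p₁ * v) W₁-1+β (cong₂ (λ u v → u + τ * v) W₀-1+β W₁-1+β))
                       (by-ring p₀ p₁ c τ)
          where by-ring : ∀ p₀ p₁ c τ → (p₀ + τ * p₁) * (p₀ + c * p₁) - p₁ * (- p₁ + τ * (p₀ + c * p₁))
                                      ≡ p₀ * p₀ + c * p₀ * p₁ + p₁ * p₁
                by-ring = solve-∀

      pivoted : α ^ D * det⊗I n S₀ ≡ α ^ D * resultant ^ D
      pivoted = begin
        α ^ D * det⊗I n S₀  ≡⟨ cong (α ^ D *_) (trans (sym det⊗I-S₁) (sym det⊗I-S₂)) ⟩
        α ^ D * det⊗I n S₂  ≡⟨ det⊗I-S₃ ⟨
        det⊗I n S₃          ≡⟨ det⊗I-upper-triangular n S₃ S₃-upper ⟩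
        product n (λ q → S₃ q q ^ D) ≡⟨ S₃-diagonal ⟩
        α ^ D * resultant ^ D ∎
        where open ≡-Reasoning

    det⊗I-sylvester-pivot : ∀ τ → Pivot.α τ ≢ 0ℤ → det⊗I n S₀ ≡ resultant ^ D
    det⊗I-sylvester-pivot τ α≢0 =
      *-cancelˡ-≡ (Pivot.α τ ^ D) _ _ {{≢-nonZero (α≢0 ∘ i^n≡0⇒i≡0 (Pivot.α τ) D)}} (Pivot.pivoted τ)

    det⊗I-sylvester : resultant ≢ 0ℤ → det⊗I n S₀ ≡ resultant ^ D
    det⊗I-sylvester resultant≢0 with p₀ ≟ 0ℤ
    ... | no  p₀≢0 = det⊗I-sylvester-pivot 0ℤ (p₀≢0 ∘ trans (sym (trans (cong (p₀ +_) (*-zeroˡ p₁)) (+-identityʳ p₀))))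
    ... | yes p₀≡0 = det⊗I-sylvester-pivot 1ℤ p₁≢0
      where
      p₁≢0 : Pivot.α 1ℤ ≢ 0ℤ
      p₁≢0 α≡0 = resultant≢0 (trans (cong₂ (λ u v → u * u + c * u * v + v * v) p₀≡0 p₁≡0) (by-ring c))
        where
        p₁≡0 : p₁ ≡ 0ℤ
        p₁≡0 = trans (sym (trans (cong₂ _+_ p₀≡0 (*-identityˡ p₁)) (+-identityˡ p₁))) α≡0
        by-ring : ∀ c → 0ℤ * 0ℤ + c * 0ℤ * 0ℤ + 0ℤ * 0ℤ ≡ 0ℤ
        by-ring = solve-∀

module Resultant where

  open import Data.Nat as ℕ using (ℕ; zero; suc; _≤_; _<_; z≤n; s≤s)
  import Data.Nat.Properties as ℕP
  open import Data.Integer using (ℤ; _+_; _*_; _^_; 0ℤ; 1ℤ)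
  open import Data.Integer.Properties
  open import Data.Integer.Tactic.RingSolver using (solve-∀)
  open import Data.Fin using (toℕ)
  open import Relation.Binary.PropositionalEquality
  open import Function using (_∘_)
  open import Data.Empty using (⊥-elim)
  open import Defs using (Poly; coeff; deg; trim; compose; det; sylvester; Res; _*ₚ_; _≈ₚ_; trinomial)
  open Sequences
  open Polynomials
  open Sylvester
  open Cofactors
  open Reduction
  open Determinants using (det-cong)

  inverseSquare : ℤ → Seq
  inverseSquare c = divG (divG (δ 0))
    where open Quadratic c

  -- The resultant of g and the cofactor of g in x^N + ε x^m + ε′.
  cofactorResultant : ℤ → ℤ → ℕ → ℕ → ℤ
  cofactorResultant c ε N m = norm c (u 2 N + ε * u 2 m) (u 3 N + ε * u 3 m)
    where u : ℕ → Seq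
          u k = shift k (inverseSquare c)

  det-sylvesterEntry-resize : ∀ P Q {a b a′ b′} → a ≡ a′ → b ≡ b′ →
    det (a ℕ.+ b) (λ i j → sylvesterEntry P Q a b (toℕ i) (toℕ j))
      ≡ det (a′ ℕ.+ b′) (λ i j → sylvesterEntry P Q a′ b′ (toℕ i) (toℕ j))
  det-sylvesterEntry-resize P Q refl refl = refl

  det-resize : ∀ {N N′} (f : ℕ → ℕ → ℤ) → N ≡ N′ → det N (λ i j → f (toℕ i) (toℕ j)) ≡ det N′ (λ i j → f (toℕ i) (toℕ j))
  det-resize f refl = refl

  module DilatedCofactor (d′ : ℕ) (c ε ε′ : ℤ) (β m₀ : ℕ) (m₀<N : m₀ < suc (suc β)) (h : Poly)
                         (g*h≈f : (quadratic c *ₚ h) ≈ₚ trinomial (suc (suc β)) m₀ ε ε′) where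
    open Quadratic c
    open Dilation d′
    open Kronecker d′ using (det⊗I)
    open Cofactor c ε ε′ β m₀ m₀<N h g*h≈f

    ĝ : Seq
    ĝ = coeff (quadratic c)

    coeff-trim-compose : ∀ p u → coeff (trim (compose D p)) u ≡ dilate (coeff p) u
    coeff-trim-compose p u = trans (coeff-trim (compose D p) u) (coeff-compose p u)

    deg-compose : ∀ p e → coeff p e ≡ 1ℤ → (∀ u → e < u → coeff p u ≡ 0ℤ) → deg (trim (compose D p)) ≡ e ℕ.* D
    deg-compose p e pₑ≡1 p-above =
      deg-trim (compose D p) (e ℕ.* D)
        (λ ≡0 → 1≢0 (trans (sym pₑ≡1) (trans (sym (dilate-* (coeff p) e)) (trans (sym (coeff-compose p (e ℕ.* D))) ≡0))))
        (λ k eD<k → trans (coeff-compose p k) (dilate-> (coeff p) e p-above k eD<k))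
      where 1≢0 : 1ℤ ≢ 0ℤ
            1≢0 ()

    ĝ-above : ∀ u → 2 < u → ĝ u ≡ 0ℤ
    ĝ-above (suc (suc (suc u))) _                 = refl
    ĝ-above (suc (suc zero))    (s≤s (s≤s ()))
    ĝ-above (suc zero)          (s≤s ())

    Res≡det⊗I : Res (compose D (quadratic c)) (compose D h) ≡ det⊗I (suc (suc β)) (sylvesterEntry ĝ H 2 β)
    Res≡det⊗I = begin
      det (deg (trim G) ℕ.+ deg (trim Hᴰ)) (sylvester (trim G) (trim Hᴰ))
        ≡⟨ det-cong (deg (trim G) ℕ.+ deg (trim Hᴰ)) (λ i j → sylvester≡ (trim G) (trim Hᴰ) i j) ⟩
      det (deg (trim G) ℕ.+ deg (trim Hᴰ))
          (λ i j → sylvesterEntry (coeff (trim G)) (coeff (trim Hᴰ)) (deg (trim G)) (deg (trim Hᴰ)) (toℕ i) (toℕ j))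
        ≡⟨ det-sylvesterEntry-resize (coeff (trim G)) (coeff (trim Hᴰ))
             (deg-compose (quadratic c) 2 refl ĝ-above) (deg-compose h β h-monic h-above) ⟩
      det (2 ℕ.* D ℕ.+ β ℕ.* D) (λ i j → sylvesterEntry (coeff (trim G)) (coeff (trim Hᴰ)) (2 ℕ.* D) (β ℕ.* D) (toℕ i) (toℕ j))
        ≡⟨ det-resize (sylvesterEntry (coeff (trim G)) (coeff (trim Hᴰ)) (2 ℕ.* D) (β ℕ.* D)) (sym (ℕP.*-distribʳ-+ D 2 β)) ⟩
      det (suc (suc β) ℕ.* D) (λ i j → sylvesterEntry (coeff (trim G)) (coeff (trim Hᴰ)) (2 ℕ.* D) (β ℕ.* D) (toℕ i) (toℕ j))
        ≡⟨ det-cong (suc (suc β) ℕ.* D) (λ i j → sylvesterEntry-dilate d′ (coeff (trim G)) (coeff (trim Hᴰ)) ĝ H 2 β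
                                 (coeff-trim-compose (quadratic c)) (coeff-trim-compose h) (toℕ i) (toℕ j)) ⟩
      det⊗I (suc (suc β)) (sylvesterEntry ĝ H 2 β) ∎
      where
      open ≡-Reasoning
      G Hᴰ : Poly
      G  = compose D (quadratic c)
      Hᴰ = compose D h

    g-reversed : ∀ t → reverse 2 ĝ t ≡ mulG (δ 0) t
    g-reversed zero                = sym (by-ring c)
      where by-ring : ∀ c → 1ℤ + c * 0ℤ + 0ℤ ≡ 1ℤ
            by-ring = solve-∀
    g-reversed (suc zero)          = sym (by-ring c)
      where by-ring : ∀ c → 0ℤ + c * 1ℤ + 0ℤ ≡ c
            by-ring = solve-∀
    g-reversed (suc (suc zero))    = sym (by-ring c)
      where by-ring : ∀ c → 0ℤ + c * 0ℤ + 1ℤ ≡ 1ℤ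
            by-ring = solve-∀
    g-reversed (suc (suc (suc t))) = trans (reverse-> 2 ĝ (3 ℕ.+ t) (s≤s (s≤s (s≤s z≤n)))) (sym (by-ring c))
      where by-ring : ∀ c → 0ℤ + c * 0ℤ + 0ℤ ≡ 0ℤ
            by-ring = solve-∀

    E : Seq
    E t = inverseSquare c t + ε * shift gap (inverseSquare c) t

    h-reversed-E : ∀ t → t ≤ β → reverse β H t ≡ mulG E t
    h-reversed-E t t≤β =
      trans (h-reversed t t≤β) (sym (mulG-binomial gap ε (inverseSquare c) (divG (δ 0)) (mulG-divG (divG (δ 0))) t))

    open SylvesterReduction d′ c β ĝ H E g-reversed h-reversed-E using (resultant; det⊗I-sylvester)

    resultant≡ : resultant ≡ cofactorResultant c ε (suc (suc β)) m₀
    resultant≡ = cong₂ (norm c) (cong (λ x → S β + ε * x) (at-m₀ 0))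
                                (trans (shift-+ 1 S (λ s → ε * shift gap S s) β)
                                       (cong (λ x → shift 1 S β + x) (trans (shift-* 1 ε (shift gap S) β)
                                                              (cong (ε *_) (trans (shift-shift 1 gap S β) (at-m₀ 1))))))
      where
      S = inverseSquare c
      at-m₀ : ∀ k → shift (k ℕ.+ gap) S β ≡ shift (2 ℕ.+ k) S m₀
      at-m₀ k = begin
        shift (k ℕ.+ gap) S β                   ≡⟨ shift-cancelˡ 2 (k ℕ.+ gap) S β ⟨
        shift (2 ℕ.+ (k ℕ.+ gap)) S (2 ℕ.+ β)   ≡⟨ cong₂ (λ i j → shift i S j) (cong (2 ℕ.+_) (ℕP.+-comm k gap)) (sym gap+m₀≡N) ⟩
        shift (2 ℕ.+ (gap ℕ.+ k)) S (gap ℕ.+ m₀) ≡⟨ cong (λ i → shift i S (gap ℕ.+ m₀)) (trans (ℕP.+-comm 2 (gap ℕ.+ k)) (ℕP.+-assoc gap k 2)) ⟩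
        shift (gap ℕ.+ (k ℕ.+ 2)) S (gap ℕ.+ m₀) ≡⟨ shift-cancelˡ gap (k ℕ.+ 2) S m₀ ⟩
        shift (k ℕ.+ 2) S m₀                    ≡⟨ cong (λ i → shift i S m₀) (ℕP.+-comm k 2) ⟩
        shift (2 ℕ.+ k) S m₀ ∎
        where open ≡-Reasoning

    Res-dilated : cofactorResultant c ε (suc (suc β)) m₀ ≢ 0ℤ →
      Res (compose D (quadratic c)) (compose D h) ≡ cofactorResultant c ε (suc (suc β)) m₀ ^ D
    Res-dilated K≢0 = trans Res≡det⊗I (trans (det⊗I-sylvester (K≢0 ∘ trans (sym resultant≡))) (cong (_^ D) resultant≡))

  Res-compose-cofactor : ∀ d′ c ε ε′ N m → 0 < m → m < N → ∀ h → (quadratic c *ₚ h) ≈ₚ trinomial N m ε ε′ →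
    cofactorResultant c ε N m ≢ 0ℤ → Res (compose (suc d′) (quadratic c)) (compose (suc d′) h) ≡ cofactorResultant c ε N m ^ suc d′
  Res-compose-cofactor d′ c ε ε′ (suc (suc β)) m 0<m m<N h g*h≈f = DilatedCofactor.Res-dilated d′ c ε ε′ β m m<N h g*h≈f
  Res-compose-cofactor d′ c ε ε′ (suc zero)    m 0<m (s≤s m≤0) = ⊥-elim (ℕP.<⇒≱ 0<m m≤0)

module NormIdentity where

  open import Data.Nat as ℕ using (ℕ; zero; suc)
  import Data.Nat.Properties as ℕP
  open import Data.Nat.DivMod using (_/_; _%_; m≡m%n+[m/n]*n)
  open import Data.Integer using (ℤ; +_; _+_; _*_; _-_; 0ℤ; 1ℤ)
  open import Data.Integer.Properties using (pos-+; pos-*)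
  open import Data.Integer.Tactic.RingSolver using (solve-∀)
  open import Relation.Binary.PropositionalEquality
  open Sequences
  open Reduction using (norm)
  open Resultant using (inverseSquare; cofactorResultant)

  module Periodicity (c : ℤ) (c²≡1 : c * c ≡ 1ℤ) where

    Annihilated : Seq → Set
    Annihilated f = ∀ t → f (2 ℕ.+ t) + c * f (1 ℕ.+ t) + f t ≡ 0ℤ

    -- 1 + c x + x² divides x³ - c when c² = 1.
    antiperiodic : ∀ (f : Seq) → Annihilated f → ∀ t → f (3 ℕ.+ t) ≡ c * f t
    antiperiodic f f-ann t = begin
      f (3 ℕ.+ t)
        ≡⟨ by-ring (f (3 ℕ.+ t)) (f (2 ℕ.+ t)) (f (1 ℕ.+ t)) (f t) c ⟩
      c * f t + (f (3 ℕ.+ t) + c * f (2 ℕ.+ t) + f (1 ℕ.+ t)) - c * (f (2 ℕ.+ t) + c * f (1 ℕ.+ t) + f t) + (c * c - 1ℤ) * f (1 ℕ.+ t)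
        ≡⟨ cong₂ (λ x y → c * f t + x - c * y + (c * c - 1ℤ) * f (1 ℕ.+ t)) (f-ann (1 ℕ.+ t)) (f-ann t) ⟩
      c * f t + 0ℤ - c * 0ℤ + (c * c - 1ℤ) * f (1 ℕ.+ t)
        ≡⟨ cong (λ x → c * f t + 0ℤ - c * 0ℤ + (x - 1ℤ) * f (1 ℕ.+ t)) c²≡1 ⟩
      c * f t + 0ℤ - c * 0ℤ + (1ℤ - 1ℤ) * f (1 ℕ.+ t)
        ≡⟨ by-ring′ (c * f t) c (f (1 ℕ.+ t)) ⟩
      c * f t ∎
      where
      open ≡-Reasoning
      by-ring : ∀ f₃ f₂ f₁ f₀ c → f₃ ≡ c * f₀ + (f₃ + c * f₂ + f₁) - c * (f₂ + c * f₁ + f₀) + (c * c - 1ℤ) * f₁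
      by-ring = solve-∀
      by-ring′ : ∀ x c y → x + 0ℤ - c * 0ℤ + (1ℤ - 1ℤ) * y ≡ x
      by-ring′ = solve-∀

    periodic : ∀ (f : Seq) → Annihilated f → ∀ t → f (6 ℕ.+ t) ≡ f t
    periodic f f-ann t = begin
      f (3 ℕ.+ (3 ℕ.+ t)) ≡⟨ antiperiodic f f-ann (3 ℕ.+ t) ⟩
      c * f (3 ℕ.+ t)     ≡⟨ cong (c *_) (antiperiodic f f-ann t) ⟩
      c * (c * f t)       ≡⟨ by-ring c (f t) ⟩
      (c * c) * f t       ≡⟨ cong (_* f t) c²≡1 ⟩
      1ℤ * f t            ≡⟨ by-ring′ (f t) ⟩
      f t ∎
      where
      open ≡-Reasoning
      by-ring : ∀ c x → c * (c * x) ≡ (c * c) * x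
      by-ring = solve-∀
      by-ring′ : ∀ x → 1ℤ * x ≡ x
      by-ring′ = solve-∀

    quasi-linear : ∀ (f φ : Seq) → (∀ t → φ (6 ℕ.+ t) ≡ φ t) → (∀ t → f (2 ℕ.+ t) + c * f (1 ℕ.+ t) + f t ≡ φ t) →
                   ∀ A t → f (A ℕ.* 6 ℕ.+ t) ≡ f t + + A * (f (6 ℕ.+ t) - f t)
    quasi-linear f φ φ-periodic gf≡φ = linear
      where
      Δ : Seq
      Δ t = f (6 ℕ.+ t) - f t
      Δ-annihilated : Annihilated Δ
      Δ-annihilated t = begin
        Δ (2 ℕ.+ t) + c * Δ (1 ℕ.+ t) + Δ t
          ≡⟨ by-ring (f (8 ℕ.+ t)) (f (7 ℕ.+ t)) (f (6 ℕ.+ t)) (f (2 ℕ.+ t)) (f (1 ℕ.+ t)) (f t) c ⟩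
        (f (8 ℕ.+ t) + c * f (7 ℕ.+ t) + f (6 ℕ.+ t)) - (f (2 ℕ.+ t) + c * f (1 ℕ.+ t) + f t)
          ≡⟨ cong₂ _-_ (gf≡φ (6 ℕ.+ t)) (gf≡φ t) ⟩
        φ (6 ℕ.+ t) - φ t
          ≡⟨ cong (_- φ t) (φ-periodic t) ⟩
        φ t - φ t
          ≡⟨ by-ring′ (φ t) ⟩
        0ℤ ∎
        where
        open ≡-Reasoning
        by-ring : ∀ a₈ a₇ a₆ a₂ a₁ a₀ c →
          (a₈ - a₂) + c * (a₇ - a₁) + (a₆ - a₀) ≡ (a₈ + c * a₇ + a₆) - (a₂ + c * a₁ + a₀)
        by-ring = solve-∀
        by-ring′ : ∀ x → x - x ≡ 0ℤ
        by-ring′ = solve-∀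
      block-+ : ∀ A t → suc A ℕ.* 6 ℕ.+ t ≡ 6 ℕ.+ (A ℕ.* 6 ℕ.+ t)
      block-+ A t = ℕP.+-assoc 6 (A ℕ.* 6) t
      Δ-along : ∀ A t → Δ (A ℕ.* 6 ℕ.+ t) ≡ Δ t
      Δ-along zero    t = refl
      Δ-along (suc A) t = trans (cong Δ (block-+ A t)) (trans (periodic Δ Δ-annihilated _) (Δ-along A t))
      linear : ∀ A t → f (A ℕ.* 6 ℕ.+ t) ≡ f t + + A * Δ t
      linear zero    t = by-ring (f t) (Δ t)
        where by-ring : ∀ x d → x ≡ x + + 0 * d
              by-ring = solve-∀
      linear (suc A) t = begin
        f (suc A ℕ.* 6 ℕ.+ t)                     ≡⟨ cong f (block-+ A t) ⟩
        f (6 ℕ.+ (A ℕ.* 6 ℕ.+ t))                 ≡⟨ by-ring (f (6 ℕ.+ (A ℕ.* 6 ℕ.+ t))) (f (A ℕ.* 6 ℕ.+ t)) ⟩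
        f (A ℕ.* 6 ℕ.+ t) + Δ (A ℕ.* 6 ℕ.+ t)     ≡⟨ cong₂ _+_ (linear A t) (Δ-along A t) ⟩
        f t + + A * Δ t + Δ t                     ≡⟨ by-ring′ (f t) (+ A) (Δ t) ⟩
        f t + (+ 1 + + A) * Δ t                   ≡⟨ cong (λ a → f t + a * Δ t) (pos-+ 1 A) ⟨
        f t + + suc A * Δ t ∎
        where
        open ≡-Reasoning
        by-ring : ∀ y x → y ≡ x + (y - x)
        by-ring = solve-∀
        by-ring′ : ∀ x a d → x + a * d + d ≡ x + (+ 1 + a) * d
        by-ring′ = solve-∀

  eisensteinNorm : ℤ → ℤ → ℤ
  eisensteinNorm x y = x * x - x * y + y * y
  {-# INLINE eisensteinNorm #-}

  -- The coefficient of x^(r + 6 a) in x² / g², which is linear in a on each residue class.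
  along : ℤ → ℕ → ℤ → ℤ
  along c r a = shift 2 (inverseSquare c) r + a * (shift 2 (inverseSquare c) (6 ℕ.+ r) - shift 2 (inverseSquare c) r)
  -- Like norm and eisensteinNorm, inlined so that solve-∀ can expand it in the instances of norm-identity.
  {-# INLINE along #-}

  module _ (c : ℤ) (c²≡1 : c * c ≡ 1ℤ) where
    open Quadratic c
    open Periodicity c c²≡1

    inverse-periodic : ∀ t → divG (δ 0) (6 ℕ.+ t) ≡ divG (δ 0) t
    inverse-periodic = periodic (divG (δ 0)) (λ t → mulG-divG (δ 0) (2 ℕ.+ t))

    shift₂-along : ∀ r A → shift 2 (inverseSquare c) (r ℕ.+ A ℕ.* 6) ≡ along c r (+ A)
    shift₂-along r A = trans (cong (shift 2 S) (ℕP.+-comm r (A ℕ.* 6)))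
                             (quasi-linear (shift 2 S) (divG (δ 0)) inverse-periodic recurrence A r)
      where
      S = inverseSquare c
      recurrence : ∀ t → shift 2 S (2 ℕ.+ t) + c * shift 2 S (1 ℕ.+ t) + shift 2 S t ≡ divG (δ 0) t
      recurrence t = trans (mulG-shift 2 S (2 ℕ.+ t)) (trans (shift-at-+ 2 (mulG S) t) (mulG-divG (divG (δ 0)) t))

    norm-identity : ∀ ε r′ s′ →
      (∀ a b → + 3 * norm c (along c (suc r′) a + ε * along c (suc s′) b) (along c r′ a + ε * along c s′ b)
                 ≡ eisensteinNorm (+ suc r′ + a * + 6) (+ suc s′ + b * + 6)) →
      ∀ n m → n % 6 ≡ suc r′ → m % 6 ≡ suc s′ → + 3 * cofactorResultant c ε n m ≡ eisensteinNorm (+ n) (+ m)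
    norm-identity ε r′ s′ identity n m n%6 m%6 =
      subst₂ (λ x y → + 3 * cofactorResultant c ε x y ≡ eisensteinNorm (+ x) (+ y)) (sym n≡) (sym m≡)
        (subst₂ (λ x y → + 3 * cofactorResultant c ε (suc r′ ℕ.+ n / 6 ℕ.* 6) (suc s′ ℕ.+ m / 6 ℕ.* 6) ≡ eisensteinNorm x y)
                (sym (pos-residue r′ (n / 6))) (sym (pos-residue s′ (m / 6)))
                (trans (cong (λ x → + 3 * x) (cong₂ (norm c) (cong₂ (λ x y → x + ε * y) (shift₂-along (suc r′) (n / 6)) (shift₂-along (suc s′) (m / 6)))
                                                       (cong₂ (λ x y → x + ε * y) (shift₂-along r′ (n / 6)) (shift₂-along s′ (m / 6)))))
                       (identity (+ (n / 6)) (+ (m / 6)))))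
      where
      n≡ : n ≡ suc r′ ℕ.+ n / 6 ℕ.* 6
      n≡ = trans (m≡m%n+[m/n]*n n 6) (cong (ℕ._+ n / 6 ℕ.* 6) n%6)
      m≡ : m ≡ suc s′ ℕ.+ m / 6 ℕ.* 6
      m≡ = trans (m≡m%n+[m/n]*n m 6) (cong (ℕ._+ m / 6 ℕ.* 6) m%6)
      pos-residue : ∀ r A → + (suc r ℕ.+ A ℕ.* 6) ≡ + suc r + + A * + 6
      pos-residue r A = trans (pos-+ (suc r) (A ℕ.* 6)) (cong (λ x → + suc r + x) (pos-* A 6))

open import Defs
open import Data.Nat using (ℕ; _<_; _∸_; _^_)
open import Data.Nat.GCD using (gcd)
open import Data.Integer using (ℤ; +_; _*_)
open import Relation.Binary.PropositionalEquality using (_≡_)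

open import Data.Nat as ℕ using (zero; suc; _≤_)
import Data.Nat.Properties as ℕP
open import Data.Integer as ℤ using (-_; _+_; _-_; 0ℤ; 1ℤ)
open import Data.Integer.Properties using (pos-+; pos-*; m-n≡m⊖n; ⊖-≥; +-injective)
open import Data.Integer.Tactic.RingSolver using (solve-∀)
open import Data.Product using (∃-syntax; _×_; _,_)
open import Data.Sum using (inj₁; inj₂)
open import Data.Empty using (⊥-elim)
open import Relation.Binary.PropositionalEquality using (_≢_; refl; sym; trans; cong; cong₂; subst₂; module ≡-Reasoning)
open Polynomials using (quadratic)
open Resultant using (cofactorResultant; Res-compose-cofactor)
open NormIdentity using (eisensteinNorm; norm-identity)

-- norm-identity takes the residues of n₀ and m₀ modulo 6 minus one.
ljunggren-norm : ∀ {n₀ m₀ ε ε′ g} → LjCase n₀ m₀ ε ε′ g → IsSign ε → IsSign ε′ →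
  ∃[ c ] (g ≡ quadratic c × + 3 * cofactorResultant c ε n₀ m₀ ≡ eisensteinNorm (+ n₀) (+ m₀))
ljunggren-norm {n₀} {m₀} (case-i (inj₁ (n₀≡1 , m₀≡5)) refl) _ (inj₁ refl) =
  1ℤ , refl , norm-identity 1ℤ refl 1ℤ 0 4 solve-∀ n₀ m₀ n₀≡1 m₀≡5
ljunggren-norm {n₀} {m₀} (case-i (inj₁ (n₀≡1 , m₀≡5)) refl) _ (inj₂ refl) =
  - 1ℤ , refl , norm-identity (- 1ℤ) refl 1ℤ 0 4 solve-∀ n₀ m₀ n₀≡1 m₀≡5
ljunggren-norm {n₀} {m₀} (case-i (inj₂ (n₀≡5 , m₀≡1)) refl) _ (inj₁ refl) =
  1ℤ , refl , norm-identity 1ℤ refl 1ℤ 4 0 solve-∀ n₀ m₀ n₀≡5 m₀≡1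
ljunggren-norm {n₀} {m₀} (case-i (inj₂ (n₀≡5 , m₀≡1)) refl) _ (inj₂ refl) =
  - 1ℤ , refl , norm-identity (- 1ℤ) refl 1ℤ 4 0 solve-∀ n₀ m₀ n₀≡5 m₀≡1
ljunggren-norm {n₀} {m₀} (case-ii (inj₁ (n₀≡2 , m₀≡1)) refl) (inj₁ refl) _ =
  1ℤ , refl , norm-identity 1ℤ refl 1ℤ 1 0 solve-∀ n₀ m₀ n₀≡2 m₀≡1
ljunggren-norm {n₀} {m₀} (case-ii (inj₁ (n₀≡2 , m₀≡1)) refl) (inj₂ refl) _ =
  - 1ℤ , refl , norm-identity (- 1ℤ) refl (- 1ℤ) 1 0 solve-∀ n₀ m₀ n₀≡2 m₀≡1
ljunggren-norm {n₀} {m₀} (case-ii (inj₂ (n₀≡4 , m₀≡5)) refl) (inj₁ refl) _ =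
  1ℤ , refl , norm-identity 1ℤ refl 1ℤ 3 4 solve-∀ n₀ m₀ n₀≡4 m₀≡5
ljunggren-norm {n₀} {m₀} (case-ii (inj₂ (n₀≡4 , m₀≡5)) refl) (inj₂ refl) _ =
  - 1ℤ , refl , norm-identity (- 1ℤ) refl (- 1ℤ) 3 4 solve-∀ n₀ m₀ n₀≡4 m₀≡5
ljunggren-norm {n₀} {m₀} (case-iii (inj₁ (n₀≡1 , m₀≡2)) refl) (inj₁ refl) _ =
  1ℤ , refl , norm-identity 1ℤ refl 1ℤ 0 1 solve-∀ n₀ m₀ n₀≡1 m₀≡2
ljunggren-norm {n₀} {m₀} (case-iii (inj₁ (n₀≡1 , m₀≡2)) refl) (inj₂ refl) _ =
  - 1ℤ , refl , norm-identity (- 1ℤ) refl (- 1ℤ) 0 1 solve-∀ n₀ m₀ n₀≡1 m₀≡2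
ljunggren-norm {n₀} {m₀} (case-iii (inj₂ (n₀≡5 , m₀≡4)) refl) (inj₁ refl) _ =
  1ℤ , refl , norm-identity 1ℤ refl 1ℤ 4 3 solve-∀ n₀ m₀ n₀≡5 m₀≡4
ljunggren-norm {n₀} {m₀} (case-iii (inj₂ (n₀≡5 , m₀≡4)) refl) (inj₂ refl) _ =
  - 1ℤ , refl , norm-identity (- 1ℤ) refl (- 1ℤ) 4 3 solve-∀ n₀ m₀ n₀≡5 m₀≡4

^-distribʳ-* : ∀ a b k → (a * b) ℤ.^ k ≡ a ℤ.^ k * b ℤ.^ k
^-distribʳ-* a b zero    = refl
^-distribʳ-* a b (suc k) = trans (cong ((a * b) *_) (^-distribʳ-* a b k)) (by-ring a b (a ℤ.^ k) (b ℤ.^ k))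
  where by-ring : ∀ a b x y → a * b * (x * y) ≡ a * x * (b * y)
        by-ring = solve-∀

eisensteinNorm-ℕ : ∀ n m → m ≤ n → eisensteinNorm (+ n) (+ m) ≡ + (n ℕ.* n ℕ.+ m ℕ.* m ∸ m ℕ.* n)
eisensteinNorm-ℕ n m m≤n = begin
  + n * + n - + n * + m + + m * + m        ≡⟨ by-ring (+ n) (+ m) ⟩
  + n * + n + + m * + m - + m * + n        ≡⟨ cong₂ _-_ (trans (pos-+ (n ℕ.* n) (m ℕ.* m)) (cong₂ _+_ (pos-* n n) (pos-* m m))) (pos-* m n) ⟨
  + (n ℕ.* n ℕ.+ m ℕ.* m) - + (m ℕ.* n)   ≡⟨ m-n≡m⊖n (n ℕ.* n ℕ.+ m ℕ.* m) (m ℕ.* n) ⟩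
  (n ℕ.* n ℕ.+ m ℕ.* m) ℤ.⊖ (m ℕ.* n)      ≡⟨ ⊖-≥ mn≤ ⟩
  + (n ℕ.* n ℕ.+ m ℕ.* m ∸ m ℕ.* n) ∎
  where
  open ≡-Reasoning
  by-ring : ∀ x y → x * x - x * y + y * y ≡ x * x + y * y - y * x
  by-ring = solve-∀
  mn≤ : m ℕ.* n ≤ n ℕ.* n ℕ.+ m ℕ.* m
  mn≤ = ℕP.≤-trans (ℕP.*-monoˡ-≤ n m≤n) (ℕP.m≤m+n (n ℕ.* n) (m ℕ.* m))

eisensteinNorm-* : ∀ x y d → eisensteinNorm (x * d) (y * d) ≡ eisensteinNorm x y * (d * d)
eisensteinNorm-* = solve-∀

eisensteinNorm-≢0 : ∀ n m → 0 < m → m ≤ n → eisensteinNorm (+ n) (+ m) ≢ 0ℤ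
eisensteinNorm-≢0 n m 0<m m≤n norm≡0 =
  ℕP.<⇒≢ (ℕP.<-≤-trans (ℕP.*-mono-< 0<m 0<m) m²≤) (sym (+-injective (trans (sym (eisensteinNorm-ℕ n m m≤n)) norm≡0)))
  where
  m²≤ : m ℕ.* m ≤ n ℕ.* n ℕ.+ m ℕ.* m ∸ m ℕ.* n
  m²≤ = ℕP.≤-trans (ℕP.m≤n+m (m ℕ.* m) (n ℕ.* n ∸ m ℕ.* n))
                   (ℕP.≤-reflexive (sym (ℕP.+-∸-comm (m ℕ.* m) (ℕP.*-monoˡ-≤ n m≤n))))

scaled-norm : ∀ K n₀ m₀ d n m → + 3 * K ≡ eisensteinNorm (+ n₀) (+ m₀) → n ≡ n₀ ℕ.* d → m ≡ m₀ ℕ.* d → m ≤ n →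
  K * + (3 ℕ.* (d ℕ.* d)) ≡ + (n ℕ.* n ℕ.+ m ℕ.* m ∸ m ℕ.* n)
scaled-norm K n₀ m₀ d n m 3K≡norm n≡ m≡ m≤n = begin
  K * + (3 ℕ.* (d ℕ.* d))                    ≡⟨ cong (K *_) (trans (pos-* 3 (d ℕ.* d)) (cong (+ 3 *_) (pos-* d d))) ⟩
  K * (+ 3 * (+ d * + d))                    ≡⟨ by-ring K (+ d) ⟩
  + 3 * K * (+ d * + d)                      ≡⟨ cong (_* (+ d * + d)) 3K≡norm ⟩
  eisensteinNorm (+ n₀) (+ m₀) * (+ d * + d) ≡⟨ eisensteinNorm-* (+ n₀) (+ m₀) (+ d) ⟨
  eisensteinNorm (+ n₀ * + d) (+ m₀ * + d)   ≡⟨ cong₂ eisensteinNorm (trans (sym (pos-* n₀ d)) (cong +_ (sym n≡)))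
                                                                    (trans (sym (pos-* m₀ d)) (cong +_ (sym m≡))) ⟩
  eisensteinNorm (+ n) (+ m)                 ≡⟨ eisensteinNorm-ℕ n m m≤n ⟩
  + (n ℕ.* n ℕ.+ m ℕ.* m ∸ m ℕ.* n) ∎
  where
  open ≡-Reasoning
  by-ring : ∀ k d → k * (+ 3 * (d * d)) ≡ + 3 * k * (d * d)
  by-ring = solve-∀

resultant-identity : ∀ n m d → 0 < m → m < n → ∀ n₀ m₀ → n ≡ n₀ ℕ.* d → m ≡ m₀ ℕ.* d →
  ∀ ε ε′ → IsSign ε → IsSign ε′ → ∀ g → LjCase n₀ m₀ ε ε′ g → ∀ h → (g *ₚ h) ≈ₚ trinomial n₀ m₀ ε ε′ →
  Res (compose d g) (compose d h) * (+ (3 ℕ.* (d ℕ.* d))) ℤ.^ d ≡ (+ (n ℕ.* n ℕ.+ m ℕ.* m ∸ m ℕ.* n)) ℤ.^ d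
resultant-identity n m zero 0<m _ _ m₀ _ m≡ = ⊥-elim (ℕP.<⇒≢ 0<m (sym (trans m≡ (ℕP.*-zeroʳ m₀))))
resultant-identity n m (suc d′) 0<m m<n n₀ m₀ n≡ m≡ ε ε′ ε± ε′± g case h g*h≈f with ljunggren-norm case ε± ε′±
... | c , refl , 3K≡norm = begin
  Res (compose D (quadratic c)) (compose D h) * (+ (3 ℕ.* (D ℕ.* D))) ℤ.^ D
    ≡⟨ cong (_* (+ (3 ℕ.* (D ℕ.* D))) ℤ.^ D) (Res-compose-cofactor d′ c ε ε′ n₀ m₀ 0<m₀ m₀<n₀ h g*h≈f K≢0) ⟩
  K ℤ.^ D * (+ (3 ℕ.* (D ℕ.* D))) ℤ.^ D
    ≡⟨ ^-distribʳ-* K (+ (3 ℕ.* (D ℕ.* D))) D ⟨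
  (K * + (3 ℕ.* (D ℕ.* D))) ℤ.^ D
    ≡⟨ cong (ℤ._^ D) (scaled-norm K n₀ m₀ D n m 3K≡norm n≡ m≡ (ℕP.<⇒≤ m<n)) ⟩
  (+ (n ℕ.* n ℕ.+ m ℕ.* m ∸ m ℕ.* n)) ℤ.^ D ∎
  where
  open ≡-Reasoning
  D = suc d′
  K = cofactorResultant c ε n₀ m₀
  m₀<n₀ : m₀ < n₀
  m₀<n₀ = ℕP.*-cancelʳ-< D m₀ n₀ (subst₂ _<_ m≡ n≡ m<n)
  0<m₀ : 0 < m₀
  0<m₀ = ℕP.n≢0⇒n>0 (λ m₀≡0 → ℕP.<⇒≢ 0<m (sym (trans m≡ (cong (ℕ._* D) m₀≡0))))
  K≢0 : K ≢ 0ℤ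
  K≢0 K≡0 = eisensteinNorm-≢0 n₀ m₀ 0<m₀ (ℕP.<⇒≤ m₀<n₀) (trans (sym 3K≡norm) (cong (+ 3 *_) K≡0))

lemma4p2 : (n m : ℕ) → 0 < m → m < n →
           (n₀ m₀ : ℕ) → n ≡ n₀ Data.Nat.* gcd n m → m ≡ m₀ Data.Nat.* gcd n m →
           (ε ε' : ℤ) → IsSign ε → IsSign ε' →
           (g : Poly) → LjCase n₀ m₀ ε ε' g →
           (h : Poly) → (g *ₚ h) ≈ₚ trinomial n₀ m₀ ε ε' →
           Res (compose (gcd n m) g) (compose (gcd n m) h)
             * (+ (3 Data.Nat.* (gcd n m Data.Nat.* gcd n m))) Data.Integer.^ gcd n m
             ≡ (+ (n Data.Nat.* n Data.Nat.+ m Data.Nat.* m ∸ m Data.Nat.* n)) Data.Integer.^ gcd n m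
lemma4p2 n m = resultant-identity n m (gcd n m)
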